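{- Let $n \equiv 3 \pmod 4$ be a strong pseudoprime to base $2$. Let $k \ge 0$ be an integer, and set $P = 2^k$ and $Q = 2^{2k-1}$ (for $k = 0$, $Q$ is interpreted as the inverse of $2$ modulo $n$, i.e. $Q \equiv (n+1)/2 \pmod n$). Then $n$ is a strong Lucas pseudoprime with parameters $(P, Q)$ and a Lucas-V pseudoprime with parameters $(P, Q)$.
   Context: For an odd integer $n>1$ write $n - 1 = d \cdot 2^s$ with $d$ odd. A composite $n$ is a strong pseudoprime to base $a$ if $a^d \equiv 1 \pmod n$ or $a^{d\cdot 2^r} \equiv -1 \pmod n$ for some $0 \le r < s$. Given $P, Q$ (here regarded as elements of $\mathbb{Z}/n\mathbb{Z}$), the Lucas sequences are $U_0 = 0$, $U_1 = 1$, $V_0 = 2$, $V_1 = P$, $U_j = PU_{j-1} - QU_{j-2}$, $V_j = PV_{j-1} - QV_{j-2}$ for $j \ge 2$, computed modulo $n$; set $D = P^2 - 4Q$. Write $n + 1 = d' \cdot 2^{s'}$ with $d'$ odd. A composite odd $n$ is a strong Lucas pseudoprime with parameters $(P,Q)$ if the Jacobi symbol $(D/n) = -1$ and either $U_{d'} \equiv 0 \pmod n$ or $V_{d' \cdot 2^r} \equiv 0 \pmod n$ for some $0 \le r < s'$. A composite odd $n$ is a Lucas-V pseudoprime with parameters $(P,Q)$ if $V_{n+1} \equiv 2Q \pmod n$. -}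

module Defs where

open import Data.Nat as ℕ using (ℕ; zero; suc; _∸_; _^_; _<_; _%_; _/_)
open import Data.Nat.Primality using (Prime; Composite)
open import Data.Integer as ℤ using (ℤ; +_; -_; _-_; _+_; _*_)
open import Data.Integer.Divisibility using (_∣_)
open import Data.Product using (Σ; ∃; _×_; _,_)
open import Data.Sum using (_⊎_)
open import Relation.Nullary using (¬_)
open import Relation.Binary.PropositionalEquality using (_≡_)

infix 4 _≋_[mod_]
_≋_[mod_] : ℤ → ℤ → ℕ → Set
a ≋ b [mod n ] = (+ n) ∣ (a - b)

OddN : ℕ → Set
OddN n = n % 2 ≡ 1

StrongPsp : ℕ → ℕ → Set
StrongPsp a n =
  Composite n × OddN n ×
  Σ ℕ λ d → Σ ℕ λ s → (n ∸ 1 ≡ d ℕ.* 2 ^ s) × OddN d ×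
    ((+ (a ^ d) ≋ + 1 [mod n ]) ⊎
     (Σ ℕ λ r → (r < s) × (+ (a ^ (d ℕ.* 2 ^ r)) ≋ - + 1 [mod n ])))

data Legendre (a : ℤ) (p : ℕ) : ℤ → Set where
  leg-zero : (+ p) ∣ a → Legendre a p (+ 0)
  leg-res  : ¬ ((+ p) ∣ a) → (Σ ℤ λ x → x * x ≋ a [mod p ]) → Legendre a p (+ 1)
  leg-non  : ¬ ((+ p) ∣ a) → ¬ (Σ ℤ λ x → x * x ≋ a [mod p ]) → Legendre a p (- + 1)

-- Jacobi symbol (a/n) for odd n, as the product of Legendre symbols over
-- the prime factorization of n (with multiplicity).  `Jacobi a n j` means
-- (a/n) = j.  (Functional by unique factorization.)
data Jacobi (a : ℤ) : ℕ → ℤ → Set where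
  jac-one   : Jacobi a 1 (+ 1)
  jac-prime : ∀ {p m l j} → Prime p → Legendre a p l → Jacobi a m j →
              Jacobi a (p ℕ.* m) (l * j)

-- Lucas sequences over ℤ (congruences mod n are then taken afterwards;
-- this agrees with computing modulo n since reduction is a ring hom).
LucasU : ℤ → ℤ → ℕ → ℤ
LucasU P Q 0 = + 0
LucasU P Q 1 = + 1
LucasU P Q (suc (suc j)) = P * LucasU P Q (suc j) - Q * LucasU P Q j

LucasV : ℤ → ℤ → ℕ → ℤ
LucasV P Q 0 = + 2
LucasV P Q 1 = P
LucasV P Q (suc (suc j)) = P * LucasV P Q (suc j) - Q * LucasV P Q j

StrongLucasPsp : ℤ → ℤ → ℕ → Set
StrongLucasPsp P Q n =
  Composite n × OddN n ×
  Jacobi (P * P - + 4 * Q) n (- + 1) ×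
  Σ ℕ λ d → Σ ℕ λ s → (n ℕ.+ 1 ≡ d ℕ.* 2 ^ s) × OddN d ×
    ((LucasU P Q d ≋ + 0 [mod n ]) ⊎
     (Σ ℕ λ r → (r < s) × (LucasV P Q (d ℕ.* 2 ^ r) ≋ + 0 [mod n ])))

LucasVPsp : ℤ → ℤ → ℕ → Set
LucasVPsp P Q n =
  Composite n × OddN n × (LucasV P Q (n ℕ.+ 1) ≋ + 2 * Q [mod n ])

Ppar : ℕ → ℤ
Ppar k = + (2 ^ k)

Qpar : ℕ → ℕ → ℤ
Qpar n zero = + ((n ℕ.+ 1) / 2)
Qpar n (suc k) = + (2 ^ (2 ℕ.* suc k ∸ 1))

module Submission where

-- Write n - 1 = 2d with d odd, so that the strong pseudoprime condition gives 2^d ≡ ε = ±1 (mod n),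
-- and x = 2^((d+1)/2) satisfies x² ≡ 2ε. For each prime p ∣ n, Euler's criterion (proved by
-- Dirichlet's pairing of residues y with c/y) together with Gauss's lemma 2^((p-1)/2) ≡ (2/p)
-- turns this into (2ε/p) = 1; multiplying over the factorisation of n gives (2/n) = ε, i.e.
-- 2^d ≡ (2/n) ≡ (-1)^((n+1)/4) because n ≡ 3 (mod 4). The parameters are P = 2a, Q = 2a² with
-- a = 2^k/2, so D = -P², (D/n) = (-1/n) = -1 and V_j(P,Q) = a^j V_j(2,2), where
-- V_j(2,2) = (1+i)^j + (1-i)^j vanishes for j ≡ 2 (mod 4) and equals 2(-4)^(j/4) for 4 ∣ j.
-- Hence V_{2·odd} ≡ 0 and V_{n+1} ≡ a^{n+1}·2·(-4)^{(n+1)/4} ≡ 4a² = 2Q (mod n).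

open import Defs
import Algebra.Properties.CommutativeSemigroup as CommutativeSemigroupProperties
open import Data.Empty using (⊥-elim)
open import Data.Fin using (Fin; toℕ; fromℕ<)
open import Data.Fin.Properties using (all?; toℕ-fromℕ<)
open import Data.Integer as ℤ using (ℤ; +_; -_; _-_; _+_; _*_; _^_; ∣_∣; 0ℤ; 1ℤ; -1ℤ)
import Data.Integer.Divisibility.Signed as Signed
open import Data.Integer.DivMod using (_%ℕ_; _/ℕ_; n%ℕd<d; a≡a%ℕn+[a/ℕn]*n)
import Data.Integer.Properties as ℤ
open import Data.Integer.Tactic.RingSolver using (solve-∀)
open import Data.List using (List; []; _∷_; length; applyUpTo)
open import Data.List.Membership.Propositional using (_∈_; find; lose)
open import Data.List.Membership.Propositional.Properties using (∈-applyUpTo⁺; ∈-applyUpTo⁻)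
open import Data.List.Properties using (length-applyUpTo)
open import Data.List.Relation.Unary.All as All using (All; []; _∷_)
open import Data.List.Relation.Unary.AllPairs using (_∷_)
open import Data.List.Relation.Unary.Any using (here; there; any?)
open import Data.List.Relation.Unary.Unique.Propositional using (Unique)
open import Data.List.Relation.Unary.Unique.Propositional.Properties using (applyUpTo⁺₁)
open import Data.Nat as ℕ using (ℕ; zero; suc; _∸_; _%_; _/_; _!; _<_; _≤_; z≤n; s≤s; NonZero)
open import Data.Nat.Coprimality using (prime⇒coprime; coprime⇒GCD≡1)
open import Data.Nat.Divisibility using (_∣_; ∣-trans; >⇒∤; n∣m⇒m%n≡0; m%n≡0⇒n∣m)
open import Data.Nat.DivMod using (%-distribˡ-*; m%n<n; m≡m%n+[m/n]*n; [m+n]%n≡m%n; [m+kn]%n≡m%n; m*n%n≡0; m*n/n≡m)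
open import Data.Nat.GCD using (module Bézout; module GCD)
open import Data.Nat.Induction using (<-rec)
open import Data.Nat.ListAction using (product)
open import Data.Nat.ListAction.Properties using (∈⇒∣product)
open import Data.Nat.Primality using (Prime; Composite; euclidsLemma; prime⇒nonZero; prime⇒nonTrivial)
open import Data.Nat.Primality.Factorisation using (factorise; PrimeFactorisation)
import Data.Nat.Properties as ℕ
open import Data.Nat.Tactic.RingSolver renaming (solve-∀ to ℕ-solve-∀)
open import Data.Product using (∃₂; ∃-syntax; _×_; _,_; proj₁; proj₂)
open import Data.Sum using (_⊎_; inj₁; inj₂; [_,_]′)
open import Function using (_∘_; _$_)
open import Relation.Binary.Bundles using (Setoid)
open import Relation.Binary.PropositionalEquality
  using (_≡_; _≢_; refl; sym; trans; cong; cong₂; subst; subst₂; module ≡-Reasoning)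
import Relation.Binary.Reasoning.Setoid as SetoidReasoning
open import Relation.Nullary using (¬_; Dec; yes; no; contradiction)
open import Relation.Nullary.Decidable using (map′; from-yes)

private
  module ℕ* = CommutativeSemigroupProperties ℕ.*-commutativeSemigroup
  module ℤ* = CommutativeSemigroupProperties ℤ.*-commutativeSemigroup

-- Defs' `_≋_[mod_]` wrapped in a record so that both sides can be inferred.
infix 4 _≈_[mod_]
record _≈_[mod_] (a b : ℤ) (m : ℕ) : Set where
  constructor mod
  field divides : + m Signed.∣ a - b

open _≈_[mod_] public using (divides)

≈⇒≋ : ∀ {m a b} → a ≈ b [mod m ] → a ≋ b [mod m ]
≈⇒≋ (mod m∣a-b) = Signed.∣⇒∣ᵤ m∣a-b

≋⇒≈ : ∀ {m a b} → a ≋ b [mod m ] → a ≈ b [mod m ]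
≋⇒≈ m∣a-b = mod (Signed.∣ᵤ⇒∣ m∣a-b)

≈0⇒∣ : ∀ {m a} → a ≈ 0ℤ [mod m ] → + m Signed.∣ a
≈0⇒∣ {m} {a} (mod m∣a-0) = subst (+ m Signed.∣_) (ℤ.+-identityʳ a) m∣a-0

module _ {m : ℕ} where

  ∣⇒≈0 : ∀ {a} → + m Signed.∣ a → a ≈ 0ℤ [mod m ]
  ∣⇒≈0 {a} m∣a = mod (subst (+ m Signed.∣_) (sym (ℤ.+-identityʳ a)) m∣a)

  ≈-reflexive : ∀ {a b} → a ≡ b → a ≈ b [mod m ]
  ≈-reflexive {a} refl = mod (Signed.divides 0ℤ (trans (ℤ.+-inverseʳ a) (sym (ℤ.*-zeroˡ (+ m)))))

  ≈-refl : ∀ {a} → a ≈ a [mod m ]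
  ≈-refl = ≈-reflexive refl

  ≈-sym : ∀ {a b} → a ≈ b [mod m ] → b ≈ a [mod m ]
  ≈-sym {a} {b} (mod d) = mod (subst (+ m Signed.∣_) (eq a b) (Signed.∣m⇒∣-m d))
    where eq : ∀ a b → - (a - b) ≡ b - a
          eq = solve-∀

  ≈-trans : ∀ {a b c} → a ≈ b [mod m ] → b ≈ c [mod m ] → a ≈ c [mod m ]
  ≈-trans {a} {b} {c} (mod d) (mod e) = mod (subst (+ m Signed.∣_) (eq a b c) (Signed.∣m∣n⇒∣m+n d e))
    where eq : ∀ a b c → (a - b) + (b - c) ≡ a - c
          eq = solve-∀

  +-cong : ∀ {a b c d} → a ≈ b [mod m ] → c ≈ d [mod m ] → a + c ≈ b + d [mod m ]
  +-cong {a} {b} {c} {d} (mod e) (mod f) = mod (subst (+ m Signed.∣_) (eq a b c d) (Signed.∣m∣n⇒∣m+n e f))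
    where eq : ∀ a b c d → (a - b) + (c - d) ≡ (a + c) - (b + d)
          eq = solve-∀

  -‿cong : ∀ {a b} → a ≈ b [mod m ] → - a ≈ - b [mod m ]
  -‿cong {a} {b} (mod e) = mod (subst (+ m Signed.∣_) (eq a b) (Signed.∣m⇒∣-m e))
    where eq : ∀ a b → - (a - b) ≡ - a - - b
          eq = solve-∀

  -‿-cong : ∀ {a b c d} → a ≈ b [mod m ] → c ≈ d [mod m ] → a - c ≈ b - d [mod m ]
  -‿-cong p q = +-cong p (-‿cong q)

  *-cong : ∀ {a b c d} → a ≈ b [mod m ] → c ≈ d [mod m ] → a * c ≈ b * d [mod m ]
  *-cong {a} {b} {c} {d} (mod e) (mod f) =
    mod (subst (+ m Signed.∣_) (eq a b c d) (Signed.∣m∣n⇒∣m+n (Signed.∣m⇒∣m*n c e) (Signed.∣n⇒∣m*n b f)))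
    where eq : ∀ a b c d → (a - b) * c + b * (c - d) ≡ a * c - b * d
          eq = solve-∀

  *-congˡ : ∀ a {b c} → b ≈ c [mod m ] → a * b ≈ a * c [mod m ]
  *-congˡ a = *-cong (≈-refl {a})

  *-congʳ : ∀ a {b c} → b ≈ c [mod m ] → b * a ≈ c * a [mod m ]
  *-congʳ a b≈c = *-cong b≈c (≈-refl {a})

  ^-cong : ∀ {a b} k → a ≈ b [mod m ] → a ^ k ≈ b ^ k [mod m ]
  ^-cong zero    p = ≈-refl
  ^-cong (suc k) p = *-cong p (^-cong k p)

≈-setoid : ℕ → Setoid _ _
≈-setoid m = record
  { Carrier = ℤ ; _≈_ = λ a b → a ≈ b [mod m ]
  ; isEquivalence = record { refl = ≈-refl ; sym = ≈-sym ; trans = ≈-trans } }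

module ≈-Reasoning (m : ℕ) = SetoidReasoning (≈-setoid m)

≈-divisor : ∀ {m d a b} → d ∣ m → a ≈ b [mod m ] → a ≈ b [mod d ]
≈-divisor d∣m (mod m∣a-b) = mod (Signed.∣-trans (Signed.∣ᵤ⇒∣ d∣m) m∣a-b)

infix 4 _≈?_[mod_]
_≈?_[mod_] : ∀ a b m → Dec (a ≈ b [mod m ])
a ≈? b [mod m ] = map′ mod divides (+ m Signed.∣? a - b)

^-distribʳ-* : ∀ a b n → (a * b) ^ n ≡ a ^ n * b ^ n
^-distribʳ-* a b zero    = refl
^-distribʳ-* a b (suc n) = trans (cong ((a * b) *_) (^-distribʳ-* a b n)) (shuffle a b (a ^ n) (b ^ n))
  where shuffle : ∀ a b c d → (a * b) * (c * d) ≡ (a * c) * (b * d)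
        shuffle = solve-∀

≈-difference : ∀ {m a b} → a - b ≈ 0ℤ [mod m ] → a ≈ b [mod m ]
≈-difference = mod ∘ ≈0⇒∣

≈0⇒∣∣ : ∀ {m a} → a ≈ 0ℤ [mod m ] → m ∣ ∣ a ∣
≈0⇒∣∣ = Signed.∣⇒∣ᵤ ∘ ≈0⇒∣

∣∣⇒≈0 : ∀ {m a} → m ∣ ∣ a ∣ → a ≈ 0ℤ [mod m ]
∣∣⇒≈0 m∣a = ∣⇒≈0 (Signed.∣ᵤ⇒∣ m∣a)

positive≉0 : ∀ {m y} → 0 < y → y < m → ¬ + y ≈ 0ℤ [mod m ]
positive≉0 {y = suc _} _ y<m y≈0 = >⇒∤ y<m (≈0⇒∣∣ y≈0)

-1≉1 : ∀ {m} → 2 < m → ¬ -1ℤ ≈ 1ℤ [mod m ]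
-1≉1 2<m -1≈1 = positive≉0 {y = 2} (s≤s z≤n) 2<m (∣⇒≈0 (divides (≈-sym -1≈1)))

private
  ordered-residues-≈⇒≡ : ∀ {m a b} → a ≤ b → b < m → + a ≈ + b [mod m ] → a ≡ b
  ordered-residues-≈⇒≡ {m} {a} {b} a≤b b<m a≈b with b ∸ a in gap
  ... | zero  = ℕ.≤-antisym a≤b (ℕ.m∸n≡0⇒m≤n gap)
  ... | suc g = ⊥-elim (>⇒∤ (ℕ.≤-<-trans (ℕ.≤-reflexive (sym gap)) (ℕ.≤-<-trans (ℕ.m∸n≤m b a) b<m)) m∣gap)
    where
    m∣gap : m ∣ suc g
    m∣gap = subst (m ∣_) (trans (cong ∣_∣ (ℤ.[+m]-[+n]≡m⊖n a b)) (trans (ℤ.∣⊖∣-≤ a≤b) gap))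
                  (Signed.∣⇒∣ᵤ (divides a≈b))

residue-unique : ∀ {m a b} → a < m → b < m → + a ≈ + b [mod m ] → a ≡ b
residue-unique {a = a} {b} a<m b<m a≈b with ℕ.≤-total a b
... | inj₁ a≤b = ordered-residues-≈⇒≡ a≤b b<m a≈b
... | inj₂ b≤a = sym (ordered-residues-≈⇒≡ b≤a a<m (≈-sym a≈b))

residue : (m : ℕ) .{{_ : NonZero m}} → ℤ → ℕ
residue m a = a %ℕ m

residue< : ∀ m .{{_ : NonZero m}} a → residue m a < m
residue< m a = n%ℕd<d a m

residue≈ : ∀ m .{{_ : NonZero m}} a → + residue m a ≈ a [mod m ]
residue≈ m a = ≈-sym (mod (Signed.divides (a /ℕ m) (cancel (a≡a%ℕn+[a/ℕn]*n a m))))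
  where
  cancel : a ≡ + residue m a + (a /ℕ m) * + m → a - + residue m a ≡ (a /ℕ m) * + m
  cancel eq = trans (cong (_- + residue m a) eq) (simplify (+ residue m a) (a /ℕ m) (+ m))
    where simplify : ∀ r q m → r + q * m - r ≡ q * m
          simplify = solve-∀

module _ {p : ℕ} (prime : Prime p) where
  private instance
    p≢0 : NonZero p
    p≢0 = prime⇒nonZero prime

  opaque
    *≈0⇒≈0⊎≈0 : ∀ {a b} → a * b ≈ 0ℤ [mod p ] → a ≈ 0ℤ [mod p ] ⊎ b ≈ 0ℤ [mod p ]
    *≈0⇒≈0⊎≈0 {a} {b} ab≈0 with euclidsLemma ∣ a ∣ ∣ b ∣ prime (subst (p ∣_) (ℤ.abs-* a b) (≈0⇒∣∣ ab≈0))
    ... | inj₁ p∣a = inj₁ (∣∣⇒≈0 p∣a)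
    ... | inj₂ p∣b = inj₂ (∣∣⇒≈0 p∣b)

    *-cancelˡ-≈ : ∀ {c a b} → ¬ c ≈ 0ℤ [mod p ] → c * a ≈ c * b [mod p ] → a ≈ b [mod p ]
    *-cancelˡ-≈ {c} {a} {b} c≉0 ca≈cb =
      [ ⊥-elim ∘ c≉0 , ≈-difference ]′ (*≈0⇒≈0⊎≈0 (≈-trans (≈-reflexive (factor c a b)) (∣⇒≈0 (divides ca≈cb))))
      where factor : ∀ c a b → c * (a - b) ≡ c * a - c * b
            factor = solve-∀

    square-roots : ∀ {x y} → x * x ≈ y * y [mod p ] → x ≈ y [mod p ] ⊎ x ≈ - y [mod p ]
    square-roots {x} {y} x²≈y² =
      [ inj₁ ∘ ≈-difference , inj₂ ∘ ≈-difference ∘ ≈-trans (≈-reflexive (cong (λ z → x + z) (ℤ.neg-involutive y))) ]′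
        (*≈0⇒≈0⊎≈0 (≈-trans (≈-reflexive (factor x y)) (∣⇒≈0 (divides x²≈y²))))
      where factor : ∀ x y → (x - y) * (x + y) ≡ x * x - y * y
            factor = solve-∀

  private
    bézout-coefficient : ∀ {d r} → Bézout.Identity d p r → ℤ
    bézout-coefficient (Bézout.+- _ y _) = - + y
    bézout-coefficient (Bézout.-+ _ y _) = + y

    bézout-coefficient-inverse : ∀ {r} (b : Bézout.Identity 1 p r) → + r * bézout-coefficient b ≈ 1ℤ [mod p ]
    bézout-coefficient-inverse {r} (Bézout.+- x y eq) = mod (Signed.divides (- + x) (begin
      + r * - + y - 1ℤ      ≡⟨ rearrange (+ r) (+ y) ⟩
      - (1ℤ + + y * + r)    ≡⟨ cong (λ z → - (1ℤ + z)) (ℤ.pos-* y r) ⟨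
      - + (1 ℕ.+ y ℕ.* r)   ≡⟨ cong (λ z → - + z) eq ⟩
      - + (x ℕ.* p)         ≡⟨ cong -_ (ℤ.pos-* x p) ⟩
      - (+ x * + p)         ≡⟨ ℤ.neg-distribˡ-* (+ x) (+ p) ⟩
      - + x * + p           ∎))
      where
      open ≡-Reasoning
      rearrange : ∀ r y → r * - y - 1ℤ ≡ - (1ℤ + y * r)
      rearrange = solve-∀
    bézout-coefficient-inverse {r} (Bézout.-+ x y eq) = mod (Signed.divides (+ x) (begin
      + r * + y - 1ℤ          ≡⟨ cong (_- 1ℤ) (ℤ.*-comm (+ r) (+ y)) ⟩
      + y * + r - 1ℤ          ≡⟨ cong (_- 1ℤ) (ℤ.pos-* y r) ⟨
      + (y ℕ.* r) - 1ℤ        ≡⟨ cong (λ z → + z - 1ℤ) eq ⟨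
      + (1 ℕ.+ x ℕ.* p) - 1ℤ  ≡⟨ cong (λ z → 1ℤ + z - 1ℤ) (ℤ.pos-* x p) ⟩
      1ℤ + + x * + p - 1ℤ     ≡⟨ cancel (+ x * + p) ⟩
      + x * + p               ∎))
      where
      open ≡-Reasoning
      cancel : ∀ z → 1ℤ + z - 1ℤ ≡ z
      cancel = solve-∀

  inverse : ℕ → ℤ
  inverse y with Bézout.lemma p y
  ... | Bézout.result _ _ b = bézout-coefficient b

  *-inverse : ∀ {y} → 0 < y → y < p → + y * inverse y ≈ 1ℤ [mod p ]
  *-inverse {suc y} _ y<p with Bézout.lemma p (suc y)
  ... | Bézout.result d g b with GCD.unique g (coprime⇒GCD≡1 (prime⇒coprime prime y<p))
  ...   | refl = bézout-coefficient-inverse b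

∸≈- : ∀ {m r} → r ≤ m → + (m ∸ r) ≈ - + r [mod m ]
∸≈- {m} {r} r≤m = mod (Signed.divides 1ℤ (begin
  + (m ∸ r) - - + r  ≡⟨ cong (λ z → + (m ∸ r) + z) (ℤ.neg-involutive (+ r)) ⟩
  + (m ∸ r) + + r    ≡⟨ ℤ.pos-+ (m ∸ r) r ⟨
  + (m ∸ r ℕ.+ r)    ≡⟨ cong +_ (ℕ.m∸n+n≡m r≤m) ⟩
  + m                ≡⟨ ℤ.*-identityˡ (+ m) ⟨
  1ℤ * + m           ∎))
  where open ≡-Reasoning

pos-^ : ∀ (a k : ℕ) → + (a ℕ.^ k) ≡ (+ a) ^ k
pos-^ a zero    = refl
pos-^ a (suc k) = trans (ℤ.pos-* a (a ℕ.^ k)) (cong (+ a *_) (pos-^ a k))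

m+1≈1 : ∀ m → + (m ℕ.+ 1) ≈ 1ℤ [mod m ]
m+1≈1 m = mod (Signed.divides 1ℤ (begin
  + (m ℕ.+ 1) - 1ℤ     ≡⟨ cong (_- 1ℤ) (ℤ.pos-+ m 1) ⟩
  + m + 1ℤ - 1ℤ        ≡⟨ cancel (+ m) ⟩
  1ℤ * + m             ∎))
  where
  open ≡-Reasoning
  cancel : ∀ x → x + 1ℤ - 1ℤ ≡ 1ℤ * x
  cancel = solve-∀

-- Dirichlet's pairing: Wilson's theorem and Euler's criterion

record Removal (x : ℕ) (xs : List ℕ) : Set where
  field
    rest     : List ℕ
    length≡  : length xs ≡ suc (length rest)
    product≡ : product xs ≡ x ℕ.* product rest
    unique   : Unique rest
    ∈⁻       : ∀ {z} → z ∈ rest → z ∈ xs × z ≢ x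
    ∈⁺       : ∀ {z} → z ∈ xs → z ≢ x → z ∈ rest

remove : ∀ {x xs} → x ∈ xs → Unique xs → Removal x xs
remove {x} {.x ∷ xs} (here refl) (x∉xs ∷ unique) = record
  { rest = xs ; length≡ = refl ; product≡ = refl ; unique = unique
  ; ∈⁻ = λ z∈xs → there z∈xs , λ { refl → All.lookup x∉xs z∈xs refl }
  ; ∈⁺ = λ { (here refl) z≢x → ⊥-elim (z≢x refl) ; (there z∈xs) _ → z∈xs } }
remove {x} {y ∷ xs} (there x∈xs) (y∉xs ∷ xs-unique) = record
  { rest     = y ∷ rest
  ; length≡  = cong suc length≡
  ; product≡ = trans (cong (y ℕ.*_) product≡) (ℕ*.x∙yz≈y∙xz y x (product rest))
  ; unique   = All.tabulate (λ z∈rest → All.lookup y∉xs (proj₁ (∈⁻ z∈rest))) ∷ unique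
  ; ∈⁻       = λ { (here refl) → here refl , λ { refl → All.lookup y∉xs x∈xs refl }
                 ; (there z∈rest) → there (proj₁ (∈⁻ z∈rest)) , proj₂ (∈⁻ z∈rest) }
  ; ∈⁺       = λ { (here refl) _ → here refl ; (there z∈xs) z≢x → there (∈⁺ z∈xs z≢x) } }
  where open Removal (remove x∈xs xs-unique)

record Pairing (τ : ℕ → ℕ) (xs : List ℕ) : Set where
  field
    closed         : ∀ {y} → y ∈ xs → τ y ∈ xs
    no-fixed-point : ∀ {y} → y ∈ xs → τ y ≢ y
    involutive     : ∀ {y} → y ∈ xs → τ (τ y) ≡ y

module _ {m : ℕ} {c : ℤ} {τ : ℕ → ℕ} where

  product-pairing : ∀ xs → Unique xs → Pairing τ xs → (∀ {y} → y ∈ xs → + y * + τ y ≈ c [mod m ]) →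
                    ∃[ k ] length xs ≡ 2 ℕ.* k × + product xs ≈ c ^ k [mod m ]
  product-pairing xs = go (length xs) xs refl
    where
    go : ∀ n xs → length xs ≡ n → Unique xs → Pairing τ xs → (∀ {y} → y ∈ xs → + y * + τ y ≈ c [mod m ]) →
         ∃[ k ] length xs ≡ 2 ℕ.* k × + product xs ≈ c ^ k [mod m ]
    go _ [] _ _ _ _ = 0 , refl , ≈-refl
    go (suc zero) (y ∷ []) _ _ pairing _ with Pairing.closed pairing (here refl)
    ... | here τy≡y = ⊥-elim (Pairing.no-fixed-point pairing (here refl) τy≡y)
    go (suc (suc n)) (y ∷ xs) len (y∉xs ∷ xs-unique) pairing partner = suc k , length≡2k , product≈
      where
      open Pairing pairing
      τy∈xs : τ y ∈ xs
      τy∈xs with closed (here refl)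
      ... | here τy≡y   = ⊥-elim (no-fixed-point (here refl) τy≡y)
      ... | there τy∈xs = τy∈xs
      open Removal (remove τy∈xs xs-unique)
      rest-pairing : Pairing τ rest
      rest-pairing = record
        { closed = λ {z} z∈rest → let z∈xs , z≢τy = ∈⁻ z∈rest in
            case-τz z∈xs z≢τy (closed (there z∈xs))
        ; no-fixed-point = λ z∈rest → no-fixed-point (there (proj₁ (∈⁻ z∈rest)))
        ; involutive = λ z∈rest → involutive (there (proj₁ (∈⁻ z∈rest))) }
        where
        case-τz : ∀ {z} → z ∈ xs → z ≢ τ y → τ z ∈ y ∷ xs → τ z ∈ rest
        case-τz {z} z∈xs z≢τy (here τz≡y) =
          ⊥-elim (z≢τy (trans (sym (involutive (there z∈xs))) (cong τ τz≡y)))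
        case-τz {z} z∈xs z≢τy (there τz∈xs) = ∈⁺ τz∈xs λ τz≡τy →
          All.lookup y∉xs (subst (_∈ xs) (trans (sym (involutive (there z∈xs)))
            (trans (cong τ τz≡τy) (involutive (here refl)))) z∈xs) refl
      IH = go n rest (ℕ.suc-injective (trans (sym length≡) (ℕ.suc-injective len))) unique rest-pairing
                (λ z∈rest → partner (there (proj₁ (∈⁻ z∈rest))))
      k = proj₁ IH
      length≡2k : suc (length xs) ≡ 2 ℕ.* suc k
      length≡2k = trans (cong suc length≡) (trans (cong (suc ∘ suc) (proj₁ (proj₂ IH))) (sym (ℕ.*-distribˡ-+ 2 1 k)))
      product≈ : + (y ℕ.* product xs) ≈ c ^ suc k [mod m ]
      product≈ = begin
        + (y ℕ.* product xs)                 ≡⟨ cong (λ P → + (y ℕ.* P)) product≡ ⟩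
        + (y ℕ.* (τ y ℕ.* product rest))       ≡⟨ cong +_ (ℕ.*-assoc y (τ y) (product rest)) ⟨
        + (y ℕ.* τ y ℕ.* product rest)         ≡⟨ ℤ.pos-* (y ℕ.* τ y) (product rest) ⟩
        + (y ℕ.* τ y) * + product rest     ≡⟨ cong (_* + product rest) (ℤ.pos-* y (τ y)) ⟩
        + y * + τ y * + product rest   ≈⟨ *-cong (partner (here refl)) (proj₂ (proj₂ IH)) ⟩
        c * c ^ k                        ∎
        where open ≈-Reasoning m

module Euler {p : ℕ} (prime : Prime p) {h : ℕ} (p≡ : p ≡ suc (2 ℕ.* h)) where
  private instance
    p≢0 : NonZero p
    p≢0 = prime⇒nonZero prime

  units : List ℕ
  units = applyUpTo suc (2 ℕ.* h)

  ∈-units⁻ : ∀ {y} → y ∈ units → 0 < y × y < p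
  ∈-units⁻ y∈units with ∈-applyUpTo⁻ suc y∈units
  ... | i , i<2h , refl = s≤s z≤n , subst (suc i <_) (sym p≡) (s≤s i<2h)

  ∈-units⁺ : ∀ {y} → 0 < y → y < p → y ∈ units
  ∈-units⁺ {suc i} _ y<p = ∈-applyUpTo⁺ suc (ℕ.≤-pred (subst (suc i <_) p≡ y<p))

  units-unique : Unique units
  units-unique = applyUpTo⁺₁ suc (2 ℕ.* h) (λ i<j _ → ℕ.<⇒≢ (s≤s i<j))

  unit≉0 : ∀ {y} → y ∈ units → ¬ + y ≈ 0ℤ [mod p ]
  unit≉0 y∈units = let 0<y , y<p = ∈-units⁻ y∈units in positive≉0 0<y y<p

  units-≈⇒≡ : ∀ {y z} → y ∈ units → z ∈ units → + y ≈ + z [mod p ] → y ≡ z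
  units-≈⇒≡ y∈units z∈units = residue-unique (proj₂ (∈-units⁻ y∈units)) (proj₂ (∈-units⁻ z∈units))

  module Partner {c : ℤ} (c≉0 : ¬ c ≈ 0ℤ [mod p ]) where

    partner : ℕ → ℕ
    partner y = residue p (c * inverse prime y)

    *-partner : ∀ {y} → y ∈ units → + y * + partner y ≈ c [mod p ]
    *-partner {y} y∈units = begin
      + y * + partner y              ≈⟨ *-congˡ (+ y) (residue≈ p (c * inverse prime y)) ⟩
      + y * (c * inverse prime y)    ≡⟨ ℤ*.x∙yz≈y∙xz (+ y) c (inverse prime y) ⟩
      c * (+ y * inverse prime y)    ≈⟨ *-congˡ c (*-inverse prime 0<y y<p) ⟩
      c * 1ℤ                         ≡⟨ ℤ.*-identityʳ c ⟩
      c                              ∎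
      where
      open ≈-Reasoning p
      0<y = proj₁ (∈-units⁻ y∈units)
      y<p = proj₂ (∈-units⁻ y∈units)

    partner-∈ : ∀ {y} → y ∈ units → partner y ∈ units
    partner-∈ {y} y∈units = ∈-units⁺ (ℕ.n≢0⇒n>0 partner≢0) (residue< p (c * inverse prime y))
      where
      partner≢0 : partner y ≢ 0
      partner≢0 partner≡0 = c≉0 (≈-trans (≈-sym (*-partner y∈units))
        (≈-reflexive (trans (cong (λ t → + y * + t) partner≡0) (ℤ.*-zeroʳ (+ y)))))

    partner-unique : ∀ {y w} → y ∈ units → w ∈ units → + y * + w ≈ c [mod p ] → partner y ≡ w
    partner-unique y∈units w∈units yw≈c = units-≈⇒≡ (partner-∈ y∈units) w∈units
      (*-cancelˡ-≈ prime (unit≉0 y∈units) (≈-trans (*-partner y∈units) (≈-sym yw≈c)))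

    partner-involutive : ∀ {y} → y ∈ units → partner (partner y) ≡ y
    partner-involutive {y} y∈units = partner-unique (partner-∈ y∈units) y∈units
      (≈-trans (≈-reflexive (ℤ.*-comm (+ partner y) (+ y))) (*-partner y∈units))

    partner≡square-root : ∀ {z w} → z ∈ units → w ∈ units → + w * + w ≈ c [mod p ] → partner z ≡ w → z ≡ w
    partner≡square-root {z} {w} z∈units w∈units w²≈c τz≡w = begin
      z                    ≡⟨ partner-involutive z∈units ⟨
      partner (partner z)  ≡⟨ cong partner τz≡w ⟩
      partner w            ≡⟨ partner-unique w∈units w∈units w²≈c ⟩
      w                    ∎
      where open ≡-Reasoning

  private
    h≡half-length : ∀ {k} → length units ≡ 2 ℕ.* k → h ≡ k
    h≡half-length {k} eq = ℕ.*-cancelˡ-≡ h k 2 (trans (sym (length-applyUpTo suc (2 ℕ.* h))) eq)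

  product-units-nonsquare : ∀ {c} → ¬ c ≈ 0ℤ [mod p ] → (∀ {y} → y ∈ units → ¬ + y * + y ≈ c [mod p ]) →
                            + product units ≈ c ^ h [mod p ]
  product-units-nonsquare {c} c≉0 nonsquare =
    let k , length≡2k , product≈cᵏ = product-pairing units units-unique pairing *-partner
    in subst (λ e → + product units ≈ c ^ e [mod p ]) (sym (h≡half-length {k} length≡2k)) product≈cᵏ
    where
    open Partner c≉0
    pairing : Pairing partner units
    pairing = record
      { closed         = partner-∈
      ; no-fixed-point = λ {y} y∈units τy≡y →
          nonsquare y∈units (subst (λ t → + y * + t ≈ c [mod p ]) τy≡y (*-partner y∈units))
      ; involutive     = partner-involutive }

  module _ {c x : ℤ} (c≉0 : ¬ c ≈ 0ℤ [mod p ]) (x²≈c : x * x ≈ c [mod p ]) where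
    private
      open Partner c≉0
      r r′ : ℕ
      r  = residue p x
      r′ = p ∸ r

      r<p : r < p
      r<p = residue< p x

      r²≈c : + r * + r ≈ c [mod p ]
      r²≈c = ≈-trans (*-cong (residue≈ p x) (residue≈ p x)) x²≈c

      r′≈-r : + r′ ≈ - + r [mod p ]
      r′≈-r = ∸≈- (ℕ.<⇒≤ r<p)

      r′²≈c : + r′ * + r′ ≈ c [mod p ]
      r′²≈c = ≈-trans (*-cong r′≈-r r′≈-r) (≈-trans (≈-reflexive (neg-square (+ r))) r²≈c)
        where neg-square : ∀ a → - a * - a ≡ a * a
              neg-square = solve-∀

      r∈units : r ∈ units
      r∈units = ∈-units⁺ (ℕ.n≢0⇒n>0 r≢0) r<p
        where
        r≢0 : r ≢ 0
        r≢0 r≡0 = c≉0 (≈-trans (≈-sym r²≈c) (≈-reflexive (cong (λ t → + t * + t) r≡0)))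

      r′∈units : r′ ∈ units
      r′∈units = ∈-units⁺ (ℕ.m<n⇒0<n∸m r<p) (ℕ.∸-monoʳ-< {p} {r} {0} (proj₁ (∈-units⁻ r∈units)) (ℕ.<⇒≤ r<p))

      r′≢r : r′ ≢ r
      r′≢r r′≡r = ℕ.even≢odd r h (begin
        2 ℕ.* r    ≡⟨ cong (r ℕ.+_) (ℕ.+-identityʳ r) ⟩
        r ℕ.+ r    ≡⟨ cong (ℕ._+ r) r′≡r ⟨
        r′ ℕ.+ r   ≡⟨ ℕ.m∸n+n≡m (ℕ.<⇒≤ r<p) ⟩
        p          ≡⟨ p≡ ⟩
        suc (2 ℕ.* h) ∎)
        where open ≡-Reasoning

      square-root-cases : ∀ {z} → z ∈ units → + z * + z ≈ c [mod p ] → z ≡ r ⊎ z ≡ r′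
      square-root-cases z∈units z²≈c with square-roots prime (≈-trans z²≈c (≈-sym r²≈c))
      ... | inj₁ z≈r  = inj₁ (units-≈⇒≡ z∈units r∈units z≈r)
      ... | inj₂ z≈-r = inj₂ (units-≈⇒≡ z∈units r′∈units (≈-trans z≈-r (≈-sym r′≈-r)))

      module R  = Removal (remove r∈units units-unique)
      module R′ = Removal (remove (R.∈⁺ r′∈units r′≢r) R.unique)

      ∈-rest⁻ : ∀ {z} → z ∈ R′.rest → z ∈ units × z ≢ r × z ≢ r′
      ∈-rest⁻ z∈rest = let z∈R , z≢r′ = R′.∈⁻ z∈rest ; z∈units , z≢r = R.∈⁻ z∈R in z∈units , z≢r , z≢r′

      ∈-rest⁺ : ∀ {z} → z ∈ units → z ≢ r → z ≢ r′ → z ∈ R′.rest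
      ∈-rest⁺ z∈units z≢r z≢r′ = R′.∈⁺ (R.∈⁺ z∈units z≢r) z≢r′

      rest-pairing : Pairing partner R′.rest
      rest-pairing = record
        { closed = λ z∈rest → let z∈units , z≢r , z≢r′ = ∈-rest⁻ z∈rest in
            ∈-rest⁺ (partner-∈ z∈units)
              (z≢r ∘ partner≡square-root z∈units r∈units r²≈c)
              (z≢r′ ∘ partner≡square-root z∈units r′∈units r′²≈c)
        ; no-fixed-point = λ {z} z∈rest τz≡z → let z∈units , z≢r , z≢r′ = ∈-rest⁻ z∈rest in
            [ z≢r , z≢r′ ]′ (square-root-cases z∈units
              (subst (λ t → + z * + t ≈ c [mod p ]) τz≡z (*-partner z∈units)))
        ; involutive = partner-involutive ∘ proj₁ ∘ ∈-rest⁻ }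

    product-units-square : + product units ≈ - c ^ h [mod p ]
    product-units-square =
      let k , length≡2k , product≈cᵏ = product-pairing R′.rest R′.unique rest-pairing (*-partner ∘ proj₁ ∘ ∈-rest⁻)
          h≡1+k = h≡half-length {suc k} (trans R.length≡ (trans (cong suc R′.length≡)
                    (trans (cong (suc ∘ suc) length≡2k) (sym (ℕ.*-distribˡ-+ 2 1 k)))))
      in subst (λ e → + product units ≈ - c ^ e [mod p ]) (sym h≡1+k) (begin
        + product units                               ≡⟨ cong +_ (trans R.product≡ (cong (r ℕ.*_) R′.product≡)) ⟩
        + (r ℕ.* (r′ ℕ.* product R′.rest))            ≡⟨ ℤ.pos-* r _ ⟩
        + r * + (r′ ℕ.* product R′.rest)              ≡⟨ cong (+ r *_) (ℤ.pos-* r′ _) ⟩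
        + r * (+ r′ * + product R′.rest)              ≈⟨ *-congˡ (+ r) (*-cong r′≈-r product≈cᵏ) ⟩
        + r * (- + r * c ^ k)                         ≡⟨ rearrange (+ r) (c ^ k) ⟩
        - (+ r * + r) * c ^ k                         ≈⟨ *-congʳ (c ^ k) (-‿cong r²≈c) ⟩
        - c * c ^ k                                   ≡⟨ ℤ.neg-distribˡ-* c (c ^ k) ⟨
        - c ^ suc k                                   ∎)
      where
      open ≈-Reasoning p
      rearrange : ∀ a b → a * (- a * b) ≡ - (a * a) * b
      rearrange = solve-∀

  private
    1<p : 1 < p
    1<p = ℕ.nonTrivial⇒n>1 p {{prime⇒nonTrivial prime}}

    1≉0 : ¬ 1ℤ ≈ 0ℤ [mod p ]
    1≉0 = positive≉0 (s≤s z≤n) 1<p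

  wilson : + product units ≈ -1ℤ [mod p ]
  wilson = ≈-trans (product-units-square {1ℤ} {1ℤ} 1≉0 ≈-refl) (≈-reflexive (cong -_ (ℤ.^-zeroˡ h)))

  euler-square : ∀ {c x} → ¬ c ≈ 0ℤ [mod p ] → x * x ≈ c [mod p ] → c ^ h ≈ 1ℤ [mod p ]
  euler-square {c} {x} c≉0 x²≈c = begin
    c ^ h       ≡⟨ ℤ.neg-involutive (c ^ h) ⟨
    - - c ^ h   ≈⟨ -‿cong (≈-trans (≈-sym (product-units-square {c} {x} c≉0 x²≈c)) wilson) ⟩
    - -1ℤ       ≡⟨⟩
    1ℤ          ∎
    where open ≈-Reasoning p

  euler-criterion : ∀ {c} → ¬ c ≈ 0ℤ [mod p ] → (∃[ x ] x * x ≈ c [mod p ]) ⊎ c ^ h ≈ -1ℤ [mod p ]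
  euler-criterion {c} c≉0 with any? (λ y → + y * + y ≈? c [mod p ]) units
  ... | yes square = let y , _ , y²≈c = find square in inj₁ (+ y , y²≈c)
  ... | no ¬square = inj₂ (≈-trans (≈-sym (product-units-nonsquare c≉0 λ y∈units y²≈c → ¬square (lose y∈units y²≈c))) wilson)

IsSign : ℤ → Set
IsSign a = a ≡ 1ℤ ⊎ a ≡ -1ℤ

isSign-* : ∀ {a b} → IsSign a → IsSign b → IsSign (a * b)
isSign-* (inj₁ refl) (inj₁ refl) = inj₁ refl
isSign-* (inj₁ refl) (inj₂ refl) = inj₂ refl
isSign-* (inj₂ refl) (inj₁ refl) = inj₂ refl
isSign-* (inj₂ refl) (inj₂ refl) = inj₁ refl

isSign-^ : ∀ e → IsSign (-1ℤ ^ e)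
isSign-^ zero    = inj₁ refl
isSign-^ (suc e) = isSign-* (inj₂ refl) (isSign-^ e)

isSign-≈1⇒≡1 : ∀ {m a} → 2 < m → IsSign a → a ≈ 1ℤ [mod m ] → a ≡ 1ℤ
isSign-≈1⇒≡1 2<m (inj₁ a≡1) _    = a≡1
isSign-≈1⇒≡1 2<m (inj₂ refl) -1≈1 = ⊥-elim (-1≉1 2<m -1≈1)

-1^-+2 : ∀ e → -1ℤ ^ (2 ℕ.+ e) ≡ -1ℤ ^ e
-1^-+2 e = neg-neg (-1ℤ ^ e)
  where neg-neg : ∀ x → -1ℤ * (-1ℤ * x) ≡ x
        neg-neg = solve-∀

-1^-even : ∀ m → -1ℤ ^ (2 ℕ.* m) ≡ 1ℤ
-1^-even zero    = refl
-1^-even (suc m) = trans (cong (-1ℤ ^_) (ℕ.*-suc 2 m)) (trans (-1^-+2 (2 ℕ.* m)) (-1^-even m))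

data Parity : ℕ → Set where
  even : ∀ m → Parity (2 ℕ.* m)
  odd  : ∀ m → Parity (suc (2 ℕ.* m))

parity : ∀ n → Parity n
parity zero = even 0
parity (suc n) with parity n
... | even m = odd m
... | odd m  = subst Parity (cong suc (ℕ.+-suc m (m ℕ.+ 0))) (even (suc m))

-- The Kronecker symbols (-1/m) and (2/m): they depend only on m mod 4 and m mod 8
-- respectively, and vanish for even m.
χ₄-table : ℕ → ℤ
χ₄-table 1 = 1ℤ
χ₄-table 3 = -1ℤ
χ₄-table _ = 0ℤ

χ₈-table : ℕ → ℤ
χ₈-table 1 = 1ℤ
χ₈-table 3 = -1ℤ
χ₈-table 5 = -1ℤ
χ₈-table 7 = 1ℤ
χ₈-table _ = 0ℤ

χ₄ χ₈ : ℕ → ℤ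
χ₄ m = χ₄-table (m % 4)
χ₈ m = χ₈-table (m % 8)

MultiplicativeTable : ∀ k .{{_ : NonZero k}} → (ℕ → ℤ) → Set
MultiplicativeTable k t = ∀ (i j : Fin k) → t (toℕ i ℕ.* toℕ j % k) ≡ t (toℕ i) * t (toℕ j)

multiplicativeTable? : ∀ k .{{_ : NonZero k}} t → Dec (MultiplicativeTable k t)
multiplicativeTable? k t = all? λ i → all? λ j → t (toℕ i ℕ.* toℕ j % k) ℤ.≟ t (toℕ i) * t (toℕ j)

multiplicative-mod : ∀ k .{{_ : NonZero k}} (t : ℕ → ℤ) → MultiplicativeTable k t →
                     ∀ m n → t (m ℕ.* n % k) ≡ t (m % k) * t (n % k)
multiplicative-mod k t table m n = begin
  t (m ℕ.* n % k)                    ≡⟨ cong t (%-distribˡ-* m n k) ⟩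
  t (m % k ℕ.* (n % k) % k)          ≡⟨ cong₂ (λ a b → t (a ℕ.* b % k)) (toℕ-fromℕ< m%k<k) (toℕ-fromℕ< n%k<k) ⟨
  t (toℕ i ℕ.* toℕ j % k)            ≡⟨ table i j ⟩
  t (toℕ i) * t (toℕ j)              ≡⟨ cong₂ (λ a b → t a * t b) (toℕ-fromℕ< m%k<k) (toℕ-fromℕ< n%k<k) ⟩
  t (m % k) * t (n % k)              ∎
  where
  open ≡-Reasoning
  m%k<k = m%n<n m k
  n%k<k = m%n<n n k
  i = fromℕ< m%k<k
  j = fromℕ< n%k<k

χ₄-* : ∀ m n → χ₄ (m ℕ.* n) ≡ χ₄ m * χ₄ n
χ₄-* = multiplicative-mod 4 χ₄-table (from-yes (multiplicativeTable? 4 χ₄-table))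

χ₈-* : ∀ m n → χ₈ (m ℕ.* n) ≡ χ₈ m * χ₈ n
χ₈-* = multiplicative-mod 8 χ₈-table (from-yes (multiplicativeTable? 8 χ₈-table))

χ₄-1+4m : ∀ m → χ₄ (1 ℕ.+ 4 ℕ.* m) ≡ 1ℤ
χ₄-1+4m m = cong χ₄-table (trans (cong (λ x → (1 ℕ.+ x) % 4) (ℕ.*-comm 4 m)) ([m+kn]%n≡m%n 1 m 4))

χ₄-3+4m : ∀ m → χ₄ (3 ℕ.+ 4 ℕ.* m) ≡ -1ℤ
χ₄-3+4m m = cong χ₄-table (trans (cong (λ x → (3 ℕ.+ x) % 4) (ℕ.*-comm 4 m)) ([m+kn]%n≡m%n 3 m 4))

χ₈-+8 : ∀ m → χ₈ (m ℕ.+ 8) ≡ χ₈ m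
χ₈-+8 m = cong χ₈-table ([m+n]%n≡m%n m 8)

χ₈-1+4m : ∀ m → χ₈ (1 ℕ.+ 4 ℕ.* m) ≡ -1ℤ ^ m
χ₈-1+4m zero          = refl
χ₈-1+4m (suc zero)    = refl
χ₈-1+4m (suc (suc m)) = begin
  χ₈ (1 ℕ.+ 4 ℕ.* (2 ℕ.+ m))        ≡⟨ cong χ₈ (shift m) ⟩
  χ₈ (1 ℕ.+ 4 ℕ.* m ℕ.+ 8)          ≡⟨ χ₈-+8 (1 ℕ.+ 4 ℕ.* m) ⟩
  χ₈ (1 ℕ.+ 4 ℕ.* m)                ≡⟨ χ₈-1+4m m ⟩
  -1ℤ ^ m                           ≡⟨ -1^-+2 m ⟨
  -1ℤ ^ (2 ℕ.+ m)                   ∎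
  where
  open ≡-Reasoning
  shift : ∀ m → 1 ℕ.+ 4 ℕ.* (2 ℕ.+ m) ≡ 1 ℕ.+ 4 ℕ.* m ℕ.+ 8
  shift = ℕ-solve-∀

χ₈-3+4m : ∀ m → χ₈ (3 ℕ.+ 4 ℕ.* m) ≡ -1ℤ ^ suc m
χ₈-3+4m zero          = refl
χ₈-3+4m (suc zero)    = refl
χ₈-3+4m (suc (suc m)) = begin
  χ₈ (3 ℕ.+ 4 ℕ.* (2 ℕ.+ m))        ≡⟨ cong χ₈ (shift m) ⟩
  χ₈ (3 ℕ.+ 4 ℕ.* m ℕ.+ 8)          ≡⟨ χ₈-+8 (3 ℕ.+ 4 ℕ.* m) ⟩
  χ₈ (3 ℕ.+ 4 ℕ.* m)                ≡⟨ χ₈-3+4m m ⟩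
  -1ℤ ^ suc m                       ≡⟨ -1^-+2 (suc m) ⟨
  -1ℤ ^ (2 ℕ.+ suc m)               ∎
  where
  open ≡-Reasoning
  shift : ∀ m → 3 ℕ.+ 4 ℕ.* (2 ℕ.+ m) ≡ 3 ℕ.+ 4 ℕ.* m ℕ.+ 8
  shift = ℕ-solve-∀

1+2[2m]≡1+4m : ∀ m → suc (2 ℕ.* (2 ℕ.* m)) ≡ 1 ℕ.+ 4 ℕ.* m
1+2[2m]≡1+4m = ℕ-solve-∀

1+2[1+2m]≡3+4m : ∀ m → suc (2 ℕ.* suc (2 ℕ.* m)) ≡ 3 ℕ.+ 4 ℕ.* m
1+2[1+2m]≡3+4m = ℕ-solve-∀

χ₄-odd : ∀ h → χ₄ (suc (2 ℕ.* h)) ≡ -1ℤ ^ h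
χ₄-odd h with parity h
... | even m = trans (cong χ₄ (1+2[2m]≡1+4m m)) (trans (χ₄-1+4m m) (sym (-1^-even m)))
... | odd m  = trans (cong χ₄ (1+2[1+2m]≡3+4m m)) (trans (χ₄-3+4m m) (cong (-1ℤ *_) (sym (-1^-even m))))

χ₈-odd-isSign : ∀ h → IsSign (χ₈ (suc (2 ℕ.* h)))
χ₈-odd-isSign h with parity h
... | even m = subst IsSign (sym (trans (cong χ₈ (1+2[2m]≡1+4m m)) (χ₈-1+4m m))) (isSign-^ m)
... | odd m  = subst IsSign (sym (trans (cong χ₈ (1+2[1+2m]≡3+4m m)) (χ₈-3+4m m))) (isSign-^ (suc m))

-- Gauss's lemma for 2

∏even ∏odd : ℕ → ℕ
∏even zero    = 1
∏even (suc m) = ∏even m ℕ.* (2 ℕ.+ 2 ℕ.* m)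
∏odd zero     = 1
∏odd (suc m)  = ∏odd m ℕ.* (1 ℕ.+ 2 ℕ.* m)

∏even-from : ℕ → ℕ → ℕ
∏even-from f zero    = 1
∏even-from f (suc c) = (2 ℕ.+ 2 ℕ.* f) ℕ.* ∏even-from (suc f) c

∏even≡2^m*m! : ∀ m → ∏even m ≡ 2 ℕ.^ m ℕ.* m !
∏even≡2^m*m! zero    = refl
∏even≡2^m*m! (suc m) = trans (cong (ℕ._* (2 ℕ.+ 2 ℕ.* m)) (∏even≡2^m*m! m)) (rearrange (2 ℕ.^ m) m (m !))
  where rearrange : ∀ a m f → a ℕ.* f ℕ.* (2 ℕ.+ 2 ℕ.* m) ≡ 2 ℕ.* a ℕ.* (f ℕ.+ m ℕ.* f)
        rearrange = ℕ-solve-∀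

∏even-+ : ∀ f c → ∏even (f ℕ.+ c) ≡ ∏even f ℕ.* ∏even-from f c
∏even-+ f zero    = trans (cong ∏even (ℕ.+-identityʳ f)) (sym (ℕ.*-identityʳ (∏even f)))
∏even-+ f (suc c) = begin
  ∏even (f ℕ.+ suc c)                                        ≡⟨ cong ∏even (ℕ.+-suc f c) ⟩
  ∏even (suc f ℕ.+ c)                                        ≡⟨ ∏even-+ (suc f) c ⟩
  ∏even f ℕ.* (2 ℕ.+ 2 ℕ.* f) ℕ.* ∏even-from (suc f) c      ≡⟨ ℕ.*-assoc (∏even f) (2 ℕ.+ 2 ℕ.* f) (∏even-from (suc f) c) ⟩
  ∏even f ℕ.* ∏even-from f (suc c)                           ∎
  where open ≡-Reasoning

2m!≡∏even*∏odd : ∀ m → (2 ℕ.* m) ! ≡ ∏even m ℕ.* ∏odd m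
2m!≡∏even*∏odd zero    = refl
2m!≡∏even*∏odd (suc m) = begin
  (2 ℕ.* suc m) !                                                   ≡⟨ cong _! (ℕ.*-suc 2 m) ⟩
  (2 ℕ.+ 2 ℕ.* m) ℕ.* ((1 ℕ.+ 2 ℕ.* m) ℕ.* (2 ℕ.* m) !)
    ≡⟨ cong (λ x → (2 ℕ.+ 2 ℕ.* m) ℕ.* ((1 ℕ.+ 2 ℕ.* m) ℕ.* x)) (2m!≡∏even*∏odd m) ⟩
  (2 ℕ.+ 2 ℕ.* m) ℕ.* ((1 ℕ.+ 2 ℕ.* m) ℕ.* (∏even m ℕ.* ∏odd m))    ≡⟨ rearrange (∏even m) (∏odd m) m ⟩
  ∏even (suc m) ℕ.* ∏odd (suc m)                                    ∎
  where
  open ≡-Reasoning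
  rearrange : ∀ a b m → (2 ℕ.+ 2 ℕ.* m) ℕ.* ((1 ℕ.+ 2 ℕ.* m) ℕ.* (a ℕ.* b)) ≡
                        a ℕ.* (2 ℕ.+ 2 ℕ.* m) ℕ.* (b ℕ.* (1 ℕ.+ 2 ℕ.* m))
  rearrange = ℕ-solve-∀

[1+2m]!≡∏even*∏odd : ∀ m → (suc (2 ℕ.* m)) ! ≡ ∏even m ℕ.* ∏odd (suc m)
[1+2m]!≡∏even*∏odd m = trans (cong (suc (2 ℕ.* m) ℕ.*_) (2m!≡∏even*∏odd m)) (rearrange (∏even m) (∏odd m) m)
  where rearrange : ∀ a b m → (1 ℕ.+ 2 ℕ.* m) ℕ.* (a ℕ.* b) ≡ a ℕ.* (b ℕ.* (1 ℕ.+ 2 ℕ.* m))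
        rearrange = ℕ-solve-∀

-- Modulo 1 + 2(f + c), the even factors 2f+2, …, 2f+2c above the middle are the
-- negatives of the odd numbers 2c−1, …, 1.
∏even-from≈ : ∀ f c → + ∏even-from f c ≈ -1ℤ ^ c * + ∏odd c [mod suc (2 ℕ.* (f ℕ.+ c)) ]
∏even-from≈ f zero    = ≈-refl
∏even-from≈ f (suc c) = subst (λ N → + ∏even-from f (suc c) ≈ -1ℤ ^ suc c * + ∏odd (suc c) [mod N ])
                              (cong (λ x → suc (2 ℕ.* x)) (sym (ℕ.+-suc f c))) (begin
  + ((2 ℕ.+ 2 ℕ.* f) ℕ.* ∏even-from (suc f) c)         ≡⟨ ℤ.pos-* (2 ℕ.+ 2 ℕ.* f) (∏even-from (suc f) c) ⟩
  + (2 ℕ.+ 2 ℕ.* f) * + ∏even-from (suc f) c           ≈⟨ *-cong even≈-odd (∏even-from≈ (suc f) c) ⟩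
  - + (1 ℕ.+ 2 ℕ.* c) * (-1ℤ ^ c * + ∏odd c)           ≡⟨ rearrange (+ (1 ℕ.+ 2 ℕ.* c)) (-1ℤ ^ c) (+ ∏odd c) ⟩
  -1ℤ ^ suc c * (+ ∏odd c * + (1 ℕ.+ 2 ℕ.* c))         ≡⟨ cong (-1ℤ ^ suc c *_) (ℤ.pos-* (∏odd c) (1 ℕ.+ 2 ℕ.* c)) ⟨
  -1ℤ ^ suc c * + ∏odd (suc c)                         ∎)
  where
  N = suc (2 ℕ.* (suc f ℕ.+ c))
  open ≈-Reasoning N
  even≈-odd : + (2 ℕ.+ 2 ℕ.* f) ≈ - + (1 ℕ.+ 2 ℕ.* c) [mod N ]
  even≈-odd = mod (Signed.divides 1ℤ difference≡N)
    where
    difference≡N : + (2 ℕ.+ 2 ℕ.* f) - - + (1 ℕ.+ 2 ℕ.* c) ≡ 1ℤ * + N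
    difference≡N = trans (cong (λ z → + (2 ℕ.+ 2 ℕ.* f) + z) (ℤ.neg-involutive (+ (1 ℕ.+ 2 ℕ.* c))))
               (trans (sym (ℤ.pos-+ (2 ℕ.+ 2 ℕ.* f) (1 ℕ.+ 2 ℕ.* c)))
               (trans (cong +_ (sum f c)) (sym (ℤ.*-identityˡ (+ N)))))
      where sum : ∀ f c → 2 ℕ.+ 2 ℕ.* f ℕ.+ (1 ℕ.+ 2 ℕ.* c) ≡ suc (2 ℕ.* (suc f ℕ.+ c))
            sum = ℕ-solve-∀
  rearrange : ∀ b s o → - b * (s * o) ≡ (-1ℤ * s) * (o * b)
  rearrange = solve-∀

module _ {p : ℕ} (prime : Prime p) where

  factorial≉0 : ∀ {k} → k < p → ¬ + (k !) ≈ 0ℤ [mod p ]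
  factorial≉0 {zero} _ = positive≉0 (s≤s z≤n) (ℕ.nonTrivial⇒n>1 p {{prime⇒nonTrivial prime}})
  factorial≉0 {suc k} k<p [1+k]!≈0 =
    [ positive≉0 (s≤s z≤n) k<p , factorial≉0 (ℕ.<-trans (ℕ.n<1+n k) k<p) ]′
      (*≈0⇒≈0⊎≈0 prime (≈-trans (≈-reflexive (sym (ℤ.pos-* (suc k) (k !)))) [1+k]!≈0))

  gauss-two : ∀ {h} f c → p ≡ suc (2 ℕ.* h) → h ≡ f ℕ.+ c → h ! ≡ ∏even f ℕ.* ∏odd c →
          (+ 2) ^ h ≈ -1ℤ ^ c [mod p ]
  gauss-two {h} f c p≡ h≡f+c h!≡ = *-cancelˡ-≈ prime (factorial≉0 h<p) (begin
    + (h !) * (+ 2) ^ h                          ≡⟨ ℤ.*-comm (+ (h !)) ((+ 2) ^ h) ⟩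
    (+ 2) ^ h * + (h !)                          ≡⟨ cong (_* + (h !)) (pos-^ 2 h) ⟨
    + (2 ℕ.^ h) * + (h !)                        ≡⟨ ℤ.pos-* (2 ℕ.^ h) (h !) ⟨
    + (2 ℕ.^ h ℕ.* h !)                          ≡⟨ cong +_ (trans (sym (∏even≡2^m*m! h)) (cong ∏even h≡f+c)) ⟩
    + ∏even (f ℕ.+ c)                            ≡⟨ cong +_ (∏even-+ f c) ⟩
    + (∏even f ℕ.* ∏even-from f c)               ≡⟨ ℤ.pos-* (∏even f) (∏even-from f c) ⟩
    + ∏even f * + ∏even-from f c                 ≈⟨ *-congˡ (+ ∏even f) ∏even-from≈′ ⟩
    + ∏even f * (-1ℤ ^ c * + ∏odd c)             ≡⟨ rearrange (+ ∏even f) (-1ℤ ^ c) (+ ∏odd c) ⟩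
    + ∏even f * + ∏odd c * -1ℤ ^ c
      ≡⟨ cong (_* -1ℤ ^ c) (trans (sym (ℤ.pos-* (∏even f) (∏odd c))) (cong +_ (sym h!≡))) ⟩
    + (h !) * -1ℤ ^ c                            ∎)
    where
    open ≈-Reasoning p
    h<p : h < p
    h<p = subst (h <_) (sym p≡) (s≤s (ℕ.m≤m+n h (h ℕ.+ 0)))
    ∏even-from≈′ : + ∏even-from f c ≈ -1ℤ ^ c * + ∏odd c [mod p ]
    ∏even-from≈′ = subst (λ N → + ∏even-from f c ≈ -1ℤ ^ c * + ∏odd c [mod N ])
                         (sym (trans p≡ (cong (λ x → suc (2 ℕ.* x)) h≡f+c))) (∏even-from≈ f c)
    rearrange : ∀ a s o → a * (s * o) ≡ a * o * s
    rearrange = solve-∀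

two-pow-half : ∀ {p h} → Prime p → p ≡ suc (2 ℕ.* h) → (+ 2) ^ h ≈ χ₈ p [mod p ]
two-pow-half {h = h} p-prime p≡ with parity h
... | even m = ≈-trans (gauss-two p-prime m m p≡ 2m≡m+m (2m!≡∏even*∏odd m))
                       (≈-reflexive (sym (trans (cong χ₈ (trans p≡ (1+2[2m]≡1+4m m))) (χ₈-1+4m m))))
  where 2m≡m+m = cong (m ℕ.+_) (ℕ.+-identityʳ m)
... | odd m  = ≈-trans (gauss-two p-prime m (suc m) p≡ 1+2m≡m+1+m ([1+2m]!≡∏even*∏odd m))
                       (≈-reflexive (sym (trans (cong χ₈ (trans p≡ (1+2[1+2m]≡3+4m m))) (χ₈-3+4m m))))
  where 1+2m≡m+1+m = trans (cong (suc ∘ (m ℕ.+_)) (ℕ.+-identityʳ m)) (sym (ℕ.+-suc m m))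

odd-1+2m : ∀ m → OddN (suc (2 ℕ.* m))
odd-1+2m m = trans (cong (λ x → suc x % 2) (ℕ.*-comm 2 m)) ([m+kn]%n≡m%n 1 m 2)

¬odd-2m : ∀ m → ¬ OddN (2 ℕ.* m)
¬odd-2m m o-odd = contradiction (trans (sym (trans (cong (_% 2) (ℕ.*-comm 2 m)) (m*n%n≡0 m 2))) o-odd) λ ()

odd⇒≡1+2[/2] : ∀ o → OddN o → o ≡ suc (2 ℕ.* (o / 2))
odd⇒≡1+2[/2] o o-odd = trans (m≡m%n+[m/n]*n o 2) (cong₂ ℕ._+_ o-odd (ℕ.*-comm (o / 2) 2))

odd-part : ∀ m → 0 < m → ∃₂ λ o e → m ≡ o ℕ.* 2 ℕ.^ e × OddN o
odd-part = <-rec _ step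
  where
  step : ∀ m → (∀ {j} → j < m → 0 < j → ∃₂ λ o e → j ≡ o ℕ.* 2 ℕ.^ e × OddN o) → 0 < m →
         ∃₂ λ o e → m ≡ o ℕ.* 2 ℕ.^ e × OddN o
  step m rec 0<m with parity m
  ... | odd j  = suc (2 ℕ.* j) , 0 , sym (ℕ.*-identityʳ _) , odd-1+2m j
  ... | even j =
    let o , e , j≡ , o-odd = rec (ℕ.m<m+n j (ℕ.<-≤-trans 0<j (ℕ.m≤m+n j 0))) 0<j
    in o , suc e , trans (cong (2 ℕ.*_) j≡) (ℕ*.x∙yz≈y∙xz 2 o (2 ℕ.^ e)) , o-odd
    where
    0<j : 0 < j
    0<j = ℕ.n≢0⇒n>0 λ { refl → ℕ.<-irrefl refl 0<m }

odd-part-unique : ∀ {o o′} e e′ → OddN o → OddN o′ → o ℕ.* 2 ℕ.^ e ≡ o′ ℕ.* 2 ℕ.^ e′ → o ≡ o′ × e ≡ e′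
odd-part-unique {o} {o′} zero zero _ _ eq = trans (sym (ℕ.*-identityʳ o)) (trans eq (ℕ.*-identityʳ o′)) , refl
odd-part-unique {o} {o′} zero (suc e′) o-odd _ eq = ⊥-elim $
  ¬odd-2m (o′ ℕ.* 2 ℕ.^ e′) (subst OddN (trans (sym (ℕ.*-identityʳ o)) (trans eq (ℕ*.x∙yz≈y∙xz o′ 2 (2 ℕ.^ e′)))) o-odd)
odd-part-unique {o} {o′} (suc e) zero o-odd o′-odd eq =
  let o′≡o , 0≡1+e = odd-part-unique zero (suc e) o′-odd o-odd (sym eq) in sym o′≡o , sym 0≡1+e
odd-part-unique {o} {o′} (suc e) (suc e′) o-odd o′-odd eq =
  let o≡o′ , e≡e′ = odd-part-unique e e′ o-odd o′-odd (ℕ.*-cancelˡ-≡ _ _ 2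
        (trans (sym (ℕ*.x∙yz≈y∙xz o 2 (2 ℕ.^ e))) (trans eq (ℕ*.x∙yz≈y∙xz o′ 2 (2 ℕ.^ e′)))))
  in o≡o′ , cong suc e≡e′

odd-divisor : ∀ {n p} → OddN n → p ∣ n → OddN p
odd-divisor {n} {p} n-odd p∣n with p % 2 in p%2 | m%n<n p 2
... | 1 | _ = refl
... | 0 | _ = contradiction (trans (sym (n∣m⇒m%n≡0 n 2 2∣n)) n-odd) λ ()
  where
  2∣n : 2 ∣ n
  2∣n = ∣-trans (m%n≡0⇒n∣m p 2 p%2) p∣n
... | suc (suc _) | s≤s (s≤s ())

prime-factor-induction : ∀ (P : ℕ → Set) {n} .{{_ : NonZero n}} → P 1 → (∀ {a b} → P a → P b → P (a ℕ.* b)) →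
                         (∀ {p} → Prime p → p ∣ n → P p) → P n
prime-factor-induction P {n} P1 P* Pp = subst P (sym isFactorisation) (go factors factorsPrime λ p∈ → p∈ )
  where
  open PrimeFactorisation (factorise n)
  go : ∀ ps → All Prime ps → (∀ {p} → p ∈ ps → p ∈ factors) → P (product ps)
  go []       []              _      = P1
  go (p ∷ ps) (p-prime ∷ prs) ⊆factors =
    P* (Pp p-prime (subst (p ∣_) (sym isFactorisation) (∈⇒∣product (⊆factors (here refl)))))
       (go ps prs (⊆factors ∘ there))

character-on-prime-factors : ∀ (χ : ℕ → ℤ) {n} .{{_ : NonZero n}} → χ 1 ≡ 1ℤ → (∀ a b → χ (a ℕ.* b) ≡ χ a * χ b) →
                             (∀ {p} → Prime p → p ∣ n → χ p ≡ 1ℤ) → χ n ≡ 1ℤ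
character-on-prime-factors χ χ1≡1 χ-* = prime-factor-induction (λ m → χ m ≡ 1ℤ) χ1≡1
  λ {a} {b} χa≡1 χb≡1 → trans (χ-* a b) (cong₂ _*_ χa≡1 χb≡1)

jacobi-* : ∀ {a m m′ j j′} → Jacobi a m j → Jacobi a m′ j′ → Jacobi a (m ℕ.* m′) (j ℤ.* j′)
jacobi-* {a} {m′ = m′} {j′ = j′} jac-one J′ = subst₂ (Jacobi a) (sym (ℕ.*-identityˡ m′)) (sym (ℤ.*-identityˡ j′)) J′
jacobi-* {a} {m′ = m′} {j′ = j′} (jac-prime {p} {m} {l} {j} p-prime L J) J′ =
  subst₂ (Jacobi a) (sym (ℕ.*-assoc p m m′)) (sym (ℤ.*-assoc l j j′)) (jac-prime p-prime L (jacobi-* J J′))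

jacobi-prime : ∀ {a p l} → Prime p → Legendre a p l → Jacobi a p l
jacobi-prime {a} {p} {l} p-prime L = subst₂ (Jacobi a) (ℕ.*-identityʳ p) (ℤ.*-identityʳ l) (jac-prime p-prime L jac-one)

module _ {p a a′ u v} (uv≈1 : u * v ≈ 1ℤ [mod p ]) (a′≈au² : a′ ≈ a * (u * u) [mod p ]) where
  private
    open ≈-Reasoning p

    square-* : ∀ x y → (x * y) * (x * y) ≡ (x * x) * (y * y)
    square-* = solve-∀

    a′v²≈a : a′ * (v * v) ≈ a [mod p ]
    a′v²≈a = begin
      a′ * (v * v)             ≈⟨ *-congʳ (v * v) a′≈au² ⟩
      a * (u * u) * (v * v)    ≡⟨ rearrange a u v ⟩
      a * ((u * v) * (u * v))  ≈⟨ *-congˡ a (*-cong uv≈1 uv≈1) ⟩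
      a * 1ℤ                   ≡⟨ ℤ.*-identityʳ a ⟩
      a                        ∎
      where rearrange : ∀ a u v → a * (u * u) * (v * v) ≡ a * ((u * v) * (u * v))
            rearrange = solve-∀

    p∤a′ : ¬ p ∣ ∣ a ∣ → ¬ p ∣ ∣ a′ ∣
    p∤a′ p∤a p∣a′ = p∤a (≈0⇒∣∣ (≈-trans (≈-sym a′v²≈a) (*-congʳ (v * v) (∣∣⇒≈0 {p} {a′} p∣a′))))

  legendre-resp-unit-square : ∀ {l} → Legendre a p l → Legendre a′ p l
  legendre-resp-unit-square (leg-zero p∣a) = leg-zero (≈0⇒∣∣ (≈-trans a′≈au² (*-congʳ (u * u) (∣∣⇒≈0 {p} {a} p∣a))))
  legendre-resp-unit-square (leg-res p∤a (x , x²≈a)) = leg-res (p∤a′ p∤a) (x * u , ≈⇒≋ (begin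
    (x * u) * (x * u)        ≡⟨ square-* x u ⟩
    (x * x) * (u * u)        ≈⟨ *-congʳ (u * u) (≋⇒≈ {p} {x * x} {a} x²≈a) ⟩
    a * (u * u)              ≈⟨ ≈-sym a′≈au² ⟩
    a′                       ∎))
  legendre-resp-unit-square (leg-non p∤a ¬square) = leg-non (p∤a′ p∤a) λ (z , z²≈a′) → ¬square (z * v , ≈⇒≋ (begin
    (z * v) * (z * v)        ≡⟨ square-* z v ⟩
    (z * z) * (v * v)        ≈⟨ *-congʳ (v * v) (≋⇒≈ {p} {z * z} {a′} z²≈a′) ⟩
    a′ * (v * v)             ≈⟨ a′v²≈a ⟩
    a                        ∎))

module SupplementaryLaws {p : ℕ} (prime : Prime p) (p-odd : OddN p) where
  private
    h : ℕ
    h = p / 2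

    p≡ : p ≡ suc (2 ℕ.* h)
    p≡ = odd⇒≡1+2[/2] p p-odd

  open Euler prime {h} p≡

  private
    1<p : 1 < p
    1<p = ℕ.nonTrivial⇒n>1 p {{prime⇒nonTrivial prime}}

    2<p : 2 < p
    2<p = ℕ.≤∧≢⇒< 1<p λ 2≡p → ℕ.even≢odd h 0 (ℕ.suc-injective (trans (sym p≡) (sym 2≡p)))

    -1≉0 : ¬ -1ℤ ≈ 0ℤ [mod p ]
    -1≉0 -1≈0 = positive≉0 (s≤s z≤n) 1<p (-‿cong -1≈0)

    χ₄≡ : χ₄ p ≡ -1ℤ ^ h
    χ₄≡ = trans (cong χ₄ p≡) (χ₄-odd h)

    χ₈-isSign : IsSign (χ₈ p)
    χ₈-isSign = subst (IsSign ∘ χ₈) (sym p≡) (χ₈-odd-isSign h)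

    legendre-minus-one-by-sign : IsSign (-1ℤ ^ h) → Legendre -1ℤ p (-1ℤ ^ h)
    legendre-minus-one-by-sign (inj₁ -1ʰ≡1) with euler-criterion -1≉0
    ... | inj₁ (x , x²≈-1) = subst (Legendre -1ℤ p) (sym -1ʰ≡1) (leg-res (-1≉0 ∘ ∣∣⇒≈0) (x , ≈⇒≋ x²≈-1))
    ... | inj₂ -1ʰ≈-1      = ⊥-elim (-1≉1 2<p (≈-trans (≈-sym -1ʰ≈-1) (≈-reflexive -1ʰ≡1)))
    legendre-minus-one-by-sign (inj₂ -1ʰ≡-1) = subst (Legendre -1ℤ p) (sym -1ʰ≡-1) (leg-non (-1≉0 ∘ ∣∣⇒≈0)
      λ (x , x²≈-1) → -1≉1 2<p (≈-trans (≈-reflexive (sym -1ʰ≡-1)) (euler-square {x = x} -1≉0 (≋⇒≈ {p} {x * x} x²≈-1))))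

  legendre-minus-one : Legendre -1ℤ p (χ₄ p)
  legendre-minus-one = subst (Legendre -1ℤ p) (sym χ₄≡) (legendre-minus-one-by-sign (isSign-^ h))

  square-two⇒χ₈≡1 : ∀ {x} → x * x ≈ + 2 [mod p ] → χ₈ p ≡ 1ℤ
  square-two⇒χ₈≡1 {x} x²≈2 = isSign-≈1⇒≡1 2<p χ₈-isSign
    (≈-trans (≈-sym (two-pow-half {h = h} prime p≡)) (euler-square {x = x} (positive≉0 (s≤s z≤n) 2<p) x²≈2))

  square-minus-two⇒χ₄χ₈≡1 : ∀ {x} → x * x ≈ - + 2 [mod p ] → χ₄ p * χ₈ p ≡ 1ℤ
  square-minus-two⇒χ₄χ₈≡1 {x} x²≈-2 = isSign-≈1⇒≡1 2<p (isSign-* (subst IsSign (sym χ₄≡) (isSign-^ h)) χ₈-isSign) (begin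
    χ₄ p * χ₈ p           ≈⟨ *-cong (≈-reflexive χ₄≡) (≈-sym (two-pow-half {h = h} prime p≡)) ⟩
    -1ℤ ^ h * (+ 2) ^ h   ≡⟨ ^-distribʳ-* -1ℤ (+ 2) h ⟨
    (- + 2) ^ h           ≈⟨ euler-square {x = x} -2≉0 x²≈-2 ⟩
    1ℤ                    ∎)
    where
    open ≈-Reasoning p
    -2≉0 : ¬ - + 2 ≈ 0ℤ [mod p ]
    -2≉0 -2≈0 = positive≉0 (s≤s z≤n) 2<p (-‿cong -2≈0)

LucasV-scale : ∀ {m P Q P′ Q′ a} → P ≈ a * P′ [mod m ] → Q ≈ a * a * Q′ [mod m ] →
               ∀ j → LucasV P Q j ≈ a ^ j * LucasV P′ Q′ j [mod m ]
LucasV-scale P≈aP′ Q≈a²Q′ zero = ≈-reflexive (sym (ℤ.*-identityˡ (+ 2)))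
LucasV-scale {P′ = P′} {a = a} P≈aP′ Q≈a²Q′ (suc zero) = ≈-trans P≈aP′ (≈-reflexive (cong (_* P′) (sym (ℤ.*-identityʳ a))))
LucasV-scale {m} {P} {Q} {P′} {Q′} {a} P≈aP′ Q≈a²Q′ (suc (suc j)) = begin
  P * V (suc j) - Q * V j
    ≈⟨ -‿-cong (*-cong P≈aP′ (scale (suc j))) (*-cong Q≈a²Q′ (scale j)) ⟩
  a * P′ * (a * a ^ j * V′ (suc j)) - a * a * Q′ * (a ^ j * V′ j)
    ≡⟨ rearrange a P′ Q′ (a ^ j) (V′ (suc j)) (V′ j) ⟩
  a * (a * a ^ j) * (P′ * V′ (suc j) - Q′ * V′ j)   ∎
  where
  open ≈-Reasoning m
  V = LucasV P Q
  V′ = LucasV P′ Q′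
  scale = LucasV-scale {m} {P} {Q} {P′} {Q′} {a} P≈aP′ Q≈a²Q′
  rearrange : ∀ a P Q aʲ x y → a * P * (a * aʲ * x) - a * a * Q * (aʲ * y) ≡ a * (a * aʲ) * (P * x - Q * y)
  rearrange = solve-∀

-- V₂₂ j = (1 + i) ^ j + (1 - i) ^ j, and (1 ± i) ^ 4 = -4.
V₂₂ : ℕ → ℤ
V₂₂ = LucasV (+ 2) (+ 2)

V₂₂-4+ : ∀ j → V₂₂ (4 ℕ.+ j) ≡ - + 4 * V₂₂ j
V₂₂-4+ j = recurrence (V₂₂ (suc j)) (V₂₂ j)
  where recurrence : ∀ x y → + 2 * (+ 2 * (+ 2 * x - + 2 * y) - + 2 * x) - + 2 * (+ 2 * x - + 2 * y) ≡ - + 4 * y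
        recurrence = solve-∀

V₂₂-4j : ∀ j → V₂₂ (4 ℕ.* j) ≡ + 2 * (- + 4) ^ j
V₂₂-4j zero    = refl
V₂₂-4j (suc j) = begin
  V₂₂ (4 ℕ.* suc j)            ≡⟨ cong V₂₂ (ℕ.*-suc 4 j) ⟩
  V₂₂ (4 ℕ.+ 4 ℕ.* j)          ≡⟨ V₂₂-4+ (4 ℕ.* j) ⟩
  - + 4 * V₂₂ (4 ℕ.* j)        ≡⟨ cong (- + 4 *_) (V₂₂-4j j) ⟩
  - + 4 * (+ 2 * (- + 4) ^ j)  ≡⟨ ℤ*.x∙yz≈y∙xz (- + 4) (+ 2) ((- + 4) ^ j) ⟩
  + 2 * (- + 4) ^ suc j        ∎
  where open ≡-Reasoning

V₂₂-2+4j : ∀ j → V₂₂ (2 ℕ.+ 4 ℕ.* j) ≡ 0ℤ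
V₂₂-2+4j zero    = refl
V₂₂-2+4j (suc j) = begin
  V₂₂ (2 ℕ.+ 4 ℕ.* suc j)          ≡⟨ cong (λ x → V₂₂ (2 ℕ.+ x)) (ℕ.*-suc 4 j) ⟩
  V₂₂ (4 ℕ.+ (2 ℕ.+ 4 ℕ.* j))      ≡⟨ V₂₂-4+ (2 ℕ.+ 4 ℕ.* j) ⟩
  - + 4 * V₂₂ (2 ℕ.+ 4 ℕ.* j)      ≡⟨ cong (- + 4 *_) (V₂₂-2+4j j) ⟩
  0ℤ                               ∎
  where open ≡-Reasoning

module Parameters {n : ℕ} (n-odd : OddN n) where

  ½ : ℤ
  ½ = + ((n ℕ.+ 1) / 2)

  2*½≈1 : + 2 * ½ ≈ 1ℤ [mod n ]
  2*½≈1 = ≈-trans (≈-reflexive (trans (sym (ℤ.pos-* 2 ((n ℕ.+ 1) / 2))) (cong +_ 2*[n+1]/2≡n+1))) (m+1≈1 n)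
    where
    h = n / 2
    n+1≡2*[1+h] : n ℕ.+ 1 ≡ 2 ℕ.* suc h
    n+1≡2*[1+h] = trans (cong (ℕ._+ 1) (odd⇒≡1+2[/2] n n-odd)) (shift h)
      where shift : ∀ h → suc (2 ℕ.* h) ℕ.+ 1 ≡ 2 ℕ.* suc h
            shift = ℕ-solve-∀
    2*[n+1]/2≡n+1 : 2 ℕ.* ((n ℕ.+ 1) / 2) ≡ n ℕ.+ 1
    2*[n+1]/2≡n+1 = begin
      2 ℕ.* ((n ℕ.+ 1) / 2)      ≡⟨ cong (λ m → 2 ℕ.* (m / 2)) n+1≡2*[1+h] ⟩
      2 ℕ.* (2 ℕ.* suc h / 2)    ≡⟨ cong (λ m → 2 ℕ.* (m / 2)) (ℕ.*-comm 2 (suc h)) ⟩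
      2 ℕ.* (suc h ℕ.* 2 / 2)    ≡⟨ cong (2 ℕ.*_) (m*n/n≡m (suc h) 2) ⟩
      2 ℕ.* suc h                ≡⟨ n+1≡2*[1+h] ⟨
      n ℕ.+ 1                    ∎
      where open ≡-Reasoning

  a : ℕ → ℤ
  a k = (+ 2) ^ k * ½

  Ppar≈a*2 : ∀ k → Ppar k ≈ a k * + 2 [mod n ]
  Ppar≈a*2 k = begin
    Ppar k                 ≡⟨ trans (pos-^ 2 k) (sym (ℤ.*-identityʳ ((+ 2) ^ k))) ⟩
    (+ 2) ^ k * 1ℤ         ≈⟨ *-congˡ ((+ 2) ^ k) (≈-sym 2*½≈1) ⟩
    (+ 2) ^ k * (+ 2 * ½)  ≡⟨ rearrange ((+ 2) ^ k) (+ 2) ½ ⟩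
    a k * + 2              ∎
    where
    open ≈-Reasoning n
    rearrange : ∀ x y z → x * (y * z) ≡ x * z * y
    rearrange = solve-∀

  Qpar≈½*Ppar² : ∀ k → Qpar n k ≈ ½ * (Ppar k * Ppar k) [mod n ]
  Qpar≈½*Ppar² zero    = ≈-reflexive (sym (ℤ.*-identityʳ ½))
  Qpar≈½*Ppar² (suc j) = begin
    + t                       ≡⟨ ℤ.*-identityˡ (+ t) ⟨
    1ℤ * + t                  ≈⟨ *-congʳ (+ t) (≈-sym 2*½≈1) ⟩
    + 2 * ½ * + t             ≡⟨ rearrange (+ 2) ½ (+ t) ⟩
    ½ * (+ 2 * + t)
      ≡⟨ cong (½ *_) (trans (sym (ℤ.pos-* 2 t)) (trans (cong +_ 2*2^[2[1+j]∸1]≡2^[1+j]²) (ℤ.pos-* 2ʲ⁺¹ 2ʲ⁺¹))) ⟩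
    ½ * (+ 2ʲ⁺¹ * + 2ʲ⁺¹)     ∎
    where
    open ≈-Reasoning n
    t = 2 ℕ.^ (2 ℕ.* suc j ∸ 1)
    2ʲ⁺¹ = 2 ℕ.^ suc j
    2*2^[2[1+j]∸1]≡2^[1+j]² : 2 ℕ.* t ≡ 2ʲ⁺¹ ℕ.* 2ʲ⁺¹
    2*2^[2[1+j]∸1]≡2^[1+j]² =
      trans (ℕ.^-distribˡ-+-* 2 (suc j) (suc j ℕ.+ 0)) (cong (λ e → 2ʲ⁺¹ ℕ.* 2 ℕ.^ e) (ℕ.+-identityʳ (suc j)))
    rearrange : ∀ x y z → x * y * z ≡ y * (x * z)
    rearrange = solve-∀

  Qpar≈a*a*2 : ∀ k → Qpar n k ≈ a k * a k * + 2 [mod n ]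
  Qpar≈a*a*2 k = begin
    Qpar n k                                  ≈⟨ Qpar≈½*Ppar² k ⟩
    ½ * (P * P)                               ≡⟨ ℤ.*-identityʳ (½ * (P * P)) ⟨
    ½ * (P * P) * 1ℤ                          ≈⟨ *-congˡ (½ * (P * P)) (≈-sym 2*½≈1) ⟩
    ½ * (P * P) * (+ 2 * ½)                   ≡⟨ cong (λ x → ½ * (x * x) * (+ 2 * ½)) (pos-^ 2 k) ⟩
    ½ * ((+ 2) ^ k * (+ 2) ^ k) * (+ 2 * ½)   ≡⟨ rearrange ½ ((+ 2) ^ k) ⟩
    a k * a k * + 2                           ∎
    where
    open ≈-Reasoning n
    P = Ppar k
    rearrange : ∀ h x → h * (x * x) * (+ 2 * h) ≡ x * h * (x * h) * + 2
    rearrange = solve-∀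

  Ppar*½ᵏ≈1 : ∀ k → Ppar k * ½ ^ k ≈ 1ℤ [mod n ]
  Ppar*½ᵏ≈1 k = begin
    Ppar k * ½ ^ k       ≡⟨ cong (_* ½ ^ k) (pos-^ 2 k) ⟩
    (+ 2) ^ k * ½ ^ k    ≡⟨ ^-distribʳ-* (+ 2) ½ k ⟨
    (+ 2 * ½) ^ k        ≈⟨ ^-cong k 2*½≈1 ⟩
    1ℤ ^ k               ≡⟨ ℤ.^-zeroˡ k ⟩
    1ℤ                   ∎
    where open ≈-Reasoning n

  discriminant≈-Ppar² : ∀ k → Ppar k * Ppar k - + 4 * Qpar n k ≈ -1ℤ * (Ppar k * Ppar k) [mod n ]
  discriminant≈-Ppar² k = begin
    P² - + 4 * Qpar n k             ≈⟨ -‿-cong (≈-refl {a = P²}) (*-congˡ (+ 4) (Qpar≈½*Ppar² k)) ⟩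
    P² - + 4 * (½ * P²)             ≡⟨ rearrange P² ½ ⟩
    P² - + 2 * (+ 2 * ½) * P²       ≈⟨ -‿-cong (≈-refl {a = P²}) (*-congʳ P² (*-congˡ (+ 2) 2*½≈1)) ⟩
    P² - + 2 * 1ℤ * P²              ≡⟨ simplify P² ⟩
    -1ℤ * P²                        ∎
    where
    open ≈-Reasoning n
    P² = Ppar k * Ppar k
    rearrange : ∀ x h → x - + 4 * (h * x) ≡ x - + 2 * (+ 2 * h) * x
    rearrange = solve-∀
    simplify : ∀ x → x - + 2 * 1ℤ * x ≡ -1ℤ * x
    simplify = solve-∀

  a^e≈1 : ∀ k e → (+ 2) ^ e ≈ 1ℤ [mod n ] → a k ^ e ≈ 1ℤ [mod n ]
  a^e≈1 k e 2ᵉ≈1 = begin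
    ((+ 2) ^ k * ½) ^ e              ≡⟨ ^-distribʳ-* ((+ 2) ^ k) ½ e ⟩
    ((+ 2) ^ k) ^ e * ½ ^ e          ≡⟨ cong (_* ½ ^ e) (^-comm (+ 2) k e) ⟩
    ((+ 2) ^ e) ^ k * ½ ^ e          ≈⟨ *-congʳ (½ ^ e) (^-cong k 2ᵉ≈1) ⟩
    1ℤ ^ k * ½ ^ e                   ≡⟨ cong (_* ½ ^ e) (ℤ.^-zeroˡ k) ⟩
    1ℤ * ½ ^ e                       ≈⟨ *-congʳ (½ ^ e) (≈-sym 2ᵉ≈1) ⟩
    (+ 2) ^ e * ½ ^ e                ≡⟨ ^-distribʳ-* (+ 2) ½ e ⟨
    (+ 2 * ½) ^ e                    ≈⟨ ^-cong e 2*½≈1 ⟩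
    1ℤ ^ e                           ≡⟨ ℤ.^-zeroˡ e ⟩
    1ℤ                               ∎
    where
    open ≈-Reasoning n
    ^-comm : ∀ x i j → (x ^ i) ^ j ≡ (x ^ j) ^ i
    ^-comm x i j = trans (ℤ.^-*-assoc x i j) (trans (cong (x ^_) (ℕ.*-comm i j)) (sym (ℤ.^-*-assoc x j i)))

module ThreeModFour {n : ℕ} (u : ℕ) (n≡3+4u : n ≡ 3 ℕ.+ 4 ℕ.* u) where
  -- Here (n - 1)/2 = 1 + 2u and (n + 1)/4 = 1 + u.

  private instance
    n≢0 : NonZero n
    n≢0 = subst NonZero (sym n≡3+4u) _

  n-odd : OddN n
  n-odd = subst OddN (sym (trans n≡3+4u (sym (1+2[1+2m]≡3+4m u)))) (odd-1+2m (suc (2 ℕ.* u)))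

  χ₄n≡-1 : χ₄ n ≡ -1ℤ
  χ₄n≡-1 = trans (cong χ₄ n≡3+4u) (χ₄-3+4m u)

  χ₈n≡-1^[1+u] : χ₈ n ≡ -1ℤ ^ suc u
  χ₈n≡-1^[1+u] = trans (cong χ₈ n≡3+4u) (χ₈-3+4m u)

  private
    n∸1≡[1+2u]*2¹ : n ∸ 1 ≡ suc (2 ℕ.* u) ℕ.* 2 ℕ.^ 1
    n∸1≡[1+2u]*2¹ = trans (cong (_∸ 1) n≡3+4u) (halve u)
      where halve : ∀ u → 2 ℕ.+ 4 ℕ.* u ≡ suc (2 ℕ.* u) ℕ.* 2 ℕ.^ 1
            halve = ℕ-solve-∀

  strong-psp⇒2ᵈ≈±1 : StrongPsp 2 n → (+ 2) ^ suc (2 ℕ.* u) ≈ 1ℤ [mod n ] ⊎ (+ 2) ^ suc (2 ℕ.* u) ≈ -1ℤ [mod n ]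
  strong-psp⇒2ᵈ≈±1 (_ , _ , d , s , n∸1≡d*2ˢ , d-odd , witness)
    with odd-part-unique {d} {suc (2 ℕ.* u)} s 1 d-odd (odd-1+2m u) (trans (sym n∸1≡d*2ˢ) n∸1≡[1+2u]*2¹)
  ... | refl , refl with witness
  ...   | inj₁ 2ᵈ≋1                     = inj₁ (≈-trans (≈-reflexive (sym (pos-^ 2 d))) (≋⇒≈ 2ᵈ≋1))
  ...   | inj₂ (zero , _ , 2ᵈ≋-1)       =
    inj₂ (≈-trans (≈-reflexive (sym (trans (cong (λ e → + (2 ℕ.^ e)) (ℕ.*-identityʳ d)) (pos-^ 2 d)))) (≋⇒≈ 2ᵈ≋-1))
  ...   | inj₂ (suc r , s≤s () , _)

  private
    [2^[1+u]]²≡2*2ᵈ : (+ 2) ^ suc u * (+ 2) ^ suc u ≡ + 2 * (+ 2) ^ suc (2 ℕ.* u)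
    [2^[1+u]]²≡2*2ᵈ = trans (sym (ℤ.^-distribˡ-+-* (+ 2) (suc u) (suc u))) (cong ((+ 2) ^_) (double u))
      where double : ∀ u → suc u ℕ.+ suc u ≡ suc (suc (2 ℕ.* u))
            double = ℕ-solve-∀

  euler-jacobi-two : (+ 2) ^ suc (2 ℕ.* u) ≈ 1ℤ [mod n ] ⊎ (+ 2) ^ suc (2 ℕ.* u) ≈ -1ℤ [mod n ] →
                     (+ 2) ^ suc (2 ℕ.* u) ≈ χ₈ n [mod n ]
  euler-jacobi-two (inj₁ 2ᵈ≈1) = ≈-trans 2ᵈ≈1 (≈-reflexive (sym χ₈n≡1))
    where
    x²≈2 : (+ 2) ^ suc u * (+ 2) ^ suc u ≈ + 2 [mod n ]
    x²≈2 = ≈-trans (≈-reflexive [2^[1+u]]²≡2*2ᵈ) (*-congˡ (+ 2) 2ᵈ≈1)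
    χ₈n≡1 : χ₈ n ≡ 1ℤ
    χ₈n≡1 = character-on-prime-factors χ₈ refl χ₈-* λ p-prime p∣n →
      SupplementaryLaws.square-two⇒χ₈≡1 p-prime (odd-divisor n-odd p∣n) {(+ 2) ^ suc u} (≈-divisor p∣n x²≈2)
  euler-jacobi-two (inj₂ 2ᵈ≈-1) = ≈-trans 2ᵈ≈-1 (≈-reflexive (sym χ₈n≡-1))
    where
    x²≈-2 : (+ 2) ^ suc u * (+ 2) ^ suc u ≈ - + 2 [mod n ]
    x²≈-2 = ≈-trans (≈-reflexive [2^[1+u]]²≡2*2ᵈ) (*-congˡ (+ 2) 2ᵈ≈-1)
    χ₄χ₈-* : ∀ a b → χ₄ (a ℕ.* b) * χ₈ (a ℕ.* b) ≡ (χ₄ a * χ₈ a) * (χ₄ b * χ₈ b)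
    χ₄χ₈-* a b = trans (cong₂ _*_ (χ₄-* a b) (χ₈-* a b)) (interchange (χ₄ a) (χ₄ b) (χ₈ a) (χ₈ b))
      where interchange : ∀ w x y z → (w * x) * (y * z) ≡ (w * y) * (x * z)
            interchange = solve-∀
    χ₄χ₈n≡1 : χ₄ n * χ₈ n ≡ 1ℤ
    χ₄χ₈n≡1 = character-on-prime-factors (λ m → χ₄ m * χ₈ m) refl χ₄χ₈-* λ p-prime p∣n →
      SupplementaryLaws.square-minus-two⇒χ₄χ₈≡1 p-prime (odd-divisor n-odd p∣n) {(+ 2) ^ suc u} (≈-divisor p∣n x²≈-2)
    χ₈n≡-1 : χ₈ n ≡ -1ℤ
    χ₈n≡-1 = trans (negate-twice (χ₈ n)) (cong (-1ℤ *_) (trans (cong (_* χ₈ n) (sym χ₄n≡-1)) χ₄χ₈n≡1))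
      where negate-twice : ∀ x → x ≡ -1ℤ * (-1ℤ * x)
            negate-twice = solve-∀

  -4^[1+u]≈2 : (+ 2) ^ suc (2 ℕ.* u) ≈ χ₈ n [mod n ] → (- + 4) ^ suc u ≈ + 2 [mod n ]
  -4^[1+u]≈2 2ᵈ≈χ₈n = begin
    (- + 4) ^ suc u                                    ≡⟨ ^-distribʳ-* -1ℤ (+ 4) (suc u) ⟩
    -1ℤ ^ suc u * (+ 2 * + 2) ^ suc u
      ≡⟨ cong (-1ℤ ^ suc u *_) (trans (^-distribʳ-* (+ 2) (+ 2) (suc u)) [2^[1+u]]²≡2*2ᵈ) ⟩
    -1ℤ ^ suc u * (+ 2 * (+ 2) ^ suc (2 ℕ.* u))
      ≈⟨ *-congˡ (-1ℤ ^ suc u) (*-congˡ (+ 2) (≈-trans 2ᵈ≈χ₈n (≈-reflexive χ₈n≡-1^[1+u]))) ⟩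
    -1ℤ ^ suc u * (+ 2 * -1ℤ ^ suc u)
      ≡⟨ ℤ*.x∙yz≈y∙xz (-1ℤ ^ suc u) (+ 2) (-1ℤ ^ suc u) ⟩
    + 2 * (-1ℤ ^ suc u * -1ℤ ^ suc u)
      ≡⟨ cong (+ 2 *_) (trans (sym (ℤ.^-distribˡ-+-* -1ℤ (suc u) (suc u))) (cong (-1ℤ ^_) (double (suc u)))) ⟩
    + 2 * -1ℤ ^ (2 ℕ.* suc u)                          ≡⟨ cong (+ 2 *_) (-1^-even (suc u)) ⟩
    + 2 * 1ℤ                                           ∎
    where
    open ≈-Reasoning n
    double : ∀ m → m ℕ.+ m ≡ 2 ℕ.* m
    double = ℕ-solve-∀

  jacobi-minus-unit-square : ∀ {D} w w⁻¹ → w * w⁻¹ ≈ 1ℤ [mod n ] → D ≈ -1ℤ * (w * w) [mod n ] → Jacobi D n -1ℤ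
  jacobi-minus-unit-square {D} w w⁻¹ ww⁻¹≈1 D≈-w² = subst (Jacobi D n) χ₄n≡-1
    (prime-factor-induction (λ m → Jacobi D m (χ₄ m)) jac-one
      (λ {a} {b} Jₐ J_b → subst (Jacobi D (a ℕ.* b)) (sym (χ₄-* a b)) (jacobi-* Jₐ J_b))
      λ {p} p-prime p∣n → jacobi-prime p-prime
        (legendre-resp-unit-square {p} {a = -1ℤ} {a′ = D} {u = w} {v = w⁻¹} (≈-divisor p∣n ww⁻¹≈1) (≈-divisor p∣n D≈-w²)
          (SupplementaryLaws.legendre-minus-one p-prime (odd-divisor n-odd p∣n))))

  open Parameters {n} n-odd

  private
    n+1≡4[1+u] : n ℕ.+ 1 ≡ 4 ℕ.* suc u
    n+1≡4[1+u] = trans (cong (ℕ._+ 1) n≡3+4u) (shift u)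
      where shift : ∀ u → 3 ℕ.+ 4 ℕ.* u ℕ.+ 1 ≡ 4 ℕ.* suc u
            shift = ℕ-solve-∀

  lucasV-congruence : ∀ k → (+ 2) ^ suc (2 ℕ.* u) ≈ 1ℤ [mod n ] ⊎ (+ 2) ^ suc (2 ℕ.* u) ≈ -1ℤ [mod n ] →
                       LucasV (Ppar k) (Qpar n k) (n ℕ.+ 1) ≈ + 2 * Qpar n k [mod n ]
  lucasV-congruence k 2ᵈ≈±1 = begin
    LucasV (Ppar k) (Qpar n k) (n ℕ.+ 1)    ≈⟨ LucasV-scale (Ppar≈a*2 k) (Qpar≈a*a*2 k) (n ℕ.+ 1) ⟩
    a k ^ (n ℕ.+ 1) * V₂₂ (n ℕ.+ 1)         ≡⟨ cong (λ m → a k ^ m * V₂₂ m) n+1≡4[1+u] ⟩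
    a k ^ (4 ℕ.* q) * V₂₂ (4 ℕ.* q)
      ≡⟨ cong₂ _*_ (trans (cong (a k ^_) (4q≡2d+2 u)) (ℤ.^-distribˡ-+-* (a k) (2 ℕ.* d) 2)) (V₂₂-4j q) ⟩
    a k ^ (2 ℕ.* d) * a k ^ 2 * (+ 2 * (- + 4) ^ q)
      ≈⟨ *-cong (*-congʳ (a k ^ 2) (a^e≈1 k (2 ℕ.* d) 2²ᵈ≈1)) (*-congˡ (+ 2) (-4^[1+u]≈2 (euler-jacobi-two 2ᵈ≈±1))) ⟩
    1ℤ * a k ^ 2 * (+ 2 * + 2)              ≡⟨ rearrange (a k) ⟩
    + 2 * (a k * a k * + 2)                 ≈⟨ *-congˡ (+ 2) (≈-sym (Qpar≈a*a*2 k)) ⟩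
    + 2 * Qpar n k                          ∎
    where
    open ≈-Reasoning n
    d q : ℕ
    d = suc (2 ℕ.* u)
    q = suc u
    4q≡2d+2 : ∀ u → 4 ℕ.* suc u ≡ 2 ℕ.* suc (2 ℕ.* u) ℕ.+ 2
    4q≡2d+2 = ℕ-solve-∀
    2²ᵈ≈1 : (+ 2) ^ (2 ℕ.* d) ≈ 1ℤ [mod n ]
    2²ᵈ≈1 = ≈-trans (≈-reflexive (trans (cong ((+ 2) ^_) (cong (d ℕ.+_) (ℕ.+-identityʳ d))) (ℤ.^-distribˡ-+-* (+ 2) d d)))
                    (square 2ᵈ≈±1)
      where
      square : (+ 2) ^ d ≈ 1ℤ [mod n ] ⊎ (+ 2) ^ d ≈ -1ℤ [mod n ] → (+ 2) ^ d * (+ 2) ^ d ≈ 1ℤ [mod n ]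
      square (inj₁ 2ᵈ≈1)  = *-cong 2ᵈ≈1 2ᵈ≈1
      square (inj₂ 2ᵈ≈-1) = *-cong 2ᵈ≈-1 2ᵈ≈-1
    rearrange : ∀ x → 1ℤ * (x * (x * 1ℤ)) * (+ 2 * + 2) ≡ + 2 * (x * x * + 2)
    rearrange = solve-∀

  lucasV-vanishes : ∀ k o → OddN o → LucasV (Ppar k) (Qpar n k) (o ℕ.* 2 ℕ.^ 1) ≈ 0ℤ [mod n ]
  lucasV-vanishes k o o-odd = begin
    LucasV (Ppar k) (Qpar n k) (o ℕ.* 2 ℕ.^ 1)          ≈⟨ LucasV-scale (Ppar≈a*2 k) (Qpar≈a*a*2 k) (o ℕ.* 2 ℕ.^ 1) ⟩
    a k ^ (o ℕ.* 2 ℕ.^ 1) * V₂₂ (o ℕ.* 2 ℕ.^ 1)         ≡⟨ cong (λ m → a k ^ (o ℕ.* 2 ℕ.^ 1) * V₂₂ m) 2o≡2+4j ⟩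
    a k ^ (o ℕ.* 2 ℕ.^ 1) * V₂₂ (2 ℕ.+ 4 ℕ.* (o / 2))   ≡⟨ cong (a k ^ (o ℕ.* 2 ℕ.^ 1) *_) (V₂₂-2+4j (o / 2)) ⟩
    a k ^ (o ℕ.* 2 ℕ.^ 1) * 0ℤ                          ≡⟨ ℤ.*-zeroʳ (a k ^ (o ℕ.* 2 ℕ.^ 1)) ⟩
    0ℤ                                                  ∎
    where
    open ≈-Reasoning n
    2o≡2+4j : o ℕ.* 2 ℕ.^ 1 ≡ 2 ℕ.+ 4 ℕ.* (o / 2)
    2o≡2+4j = trans (cong (λ x → x ℕ.* 2 ℕ.^ 1) (odd⇒≡1+2[/2] o o-odd)) (double (o / 2))
      where double : ∀ j → suc (2 ℕ.* j) ℕ.* 2 ℕ.^ 1 ≡ 2 ℕ.+ 4 ℕ.* j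
            double = ℕ-solve-∀

  strong-lucas-pseudoprime : ∀ k → Composite n → StrongLucasPsp (Ppar k) (Qpar n k) n
  strong-lucas-pseudoprime k composite with odd-part (suc u) (s≤s z≤n)
  ... | o , e , 1+u≡o*2ᵉ , o-odd =
    composite , n-odd , jacobi-minus-unit-square (Ppar k) (½ ^ k) (Ppar*½ᵏ≈1 k) (discriminant≈-Ppar² k) ,
    o , suc (suc e) , n+1≡o*2^[2+e] , o-odd , inj₂ (1 , s≤s (s≤s z≤n) , ≈⇒≋ (lucasV-vanishes k o o-odd))
    where
    n+1≡o*2^[2+e] : n ℕ.+ 1 ≡ o ℕ.* 2 ℕ.^ suc (suc e)
    n+1≡o*2^[2+e] = trans n+1≡4[1+u] (trans (cong (4 ℕ.*_) 1+u≡o*2ᵉ) (shift o (2 ℕ.^ e)))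
      where shift : ∀ o x → 4 ℕ.* (o ℕ.* x) ≡ o ℕ.* (2 ℕ.* (2 ℕ.* x))
            shift = ℕ-solve-∀

  lucasV-pseudoprime : ∀ k → StrongPsp 2 n → LucasVPsp (Ppar k) (Qpar n k) n
  lucasV-pseudoprime k psp@(composite , _) =
    composite , n-odd , ≈⇒≋ (lucasV-congruence k (strong-psp⇒2ᵈ≈±1 psp))

theorem1 : (n k : ℕ) → n % 4 ≡ 3 → StrongPsp 2 n →
    StrongLucasPsp (Ppar k) (Qpar n k) n × LucasVPsp (Ppar k) (Qpar n k) n
theorem1 n k n%4≡3 psp@(composite , _) =
  strong-lucas-pseudoprime k composite , lucasV-pseudoprime k psp
  where open ThreeModFour (n / 4) (trans (m≡m%n+[m/n]*n n 4) (cong₂ ℕ._+_ n%4≡3 (ℕ.*-comm (n / 4) 4)))
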